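{- Let $n\ge 1$ and let $T_0=I\times J\times K\subseteq\{1,\ldots,n\}^3$ be a compact brick of size $a\times b\times c$ (so $a,b,c\le n$) with potential $p_0$. Suppose that 1. $N_x(i,T_0)\ge b+c-n$ for every $i\in I$, 2. $N_y(j,T_0)\ge a+c-n$ for every $j\in J$, 3. $N_z(\sigma,T_0)\ge a+b-n$ for every $\sigma\in K$, 4. $p_0\le \operatorname{cap}(n,a,b,c)$. Then $T_0$ is embeddable in order $n$, i.e. there exists a set $R$ of $n^2-p_0$ cells of $\{1,\ldots,n\}^3\setminus T_0$ such that no two cells of $R$ lie on a common line and no cell of $R$ lies on a line that contains a marked cell of $T_0$.
   Context: Work in the cube $\{1,\ldots,n\}^3$. A line (file) is a set of $n$ cells obtained by fixing two of the three coordinates. A brick of size $a\times b\times c$ is a set $T_0=I\times J\times K$ with $I,J,K\subseteq\{1,\ldots,n\}$, $|I|=a$, $|J|=b$, $|K|=c$. Suppose some cells of $T_0$ are marked, each marked cell being either a rook or a dot, such that no two rooks lie on a common line and no line containing a rook of $T_0$ contains a dot of $T_0$. For $i\in I$, the layer $\{i\}\times J\times K$ is called possible if the number of $\sigma\in K$ such that $\{i\}\times J\times\{\sigma\}$ contains a marked cell equals the number of $j\in J$ such that $\{i\}\times\{j\}\times K$ contains a marked cell; this common number is the potential $N_x(i,T_0)$ of the layer. Layers $I\times\{j\}\times K$ ($j\in J$) and $I\times J\times\{\sigma\}$ ($\sigma\in K$), their possibility and potentials $N_y(j,T_0)$, $N_z(\sigma,T_0)$ are defined analogously (counting, within the layer,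 the marked lines parallel to each of the two directions of the layer). $T_0$ (with its marking) is a compact brick if every layer of $T_0$ is possible and $\sum_{i\in I}N_x(i,T_0)=\sum_{j\in J}N_y(j,T_0)=\sum_{\sigma\in K}N_z(\sigma,T_0)$; this common value $p_0$ is the potential of $T_0$. The capacity is $\operatorname{cap}(n,a,b,c)=ab-(n-c)(a+b-n)=ab+bc+ca-n(a+b+c)+n^2$. -}

module Defs where

open import Data.Nat using (ℕ; zero; suc; _+_)
open import Data.Bool using (Bool; true; false; _∧_; _∨_; if_then_else_)
open import Data.Fin using (Fin)
import Data.Fin as F
open import Data.Fin.Subset using (Subset)
open import Data.Vec using (lookup)
open import Data.Product using (_×_; _,_)
open import Data.Sum using (_⊎_)
open import Data.Empty using (⊥)
open import Relation.Nullary using (¬_)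
open import Relation.Binary.PropositionalEquality using (_≡_; _≢_)

Cell : ℕ → Set
Cell n = Fin n × Fin n × Fin n

data Mark : Set where
  blank rook dot : Mark

isMarked : Mark → Bool
isMarked blank = false
isMarked rook  = true
isMarked dot   = true

count : ∀ {n} → (Fin n → Bool) → ℕ
count {zero}  f = 0
count {suc n} f = (if f F.zero then 1 else 0) + count (λ k → f (F.suc k))

anyF : ∀ {n} → (Fin n → Bool) → Bool
anyF {zero}  f = false
anyF {suc n} f = f F.zero ∨ anyF (λ k → f (F.suc k))

sumF : ∀ {n} → (Fin n → ℕ) → ℕ
sumF {zero}  f = 0
sumF {suc n} f = f F.zero + sumF (λ k → f (F.suc k))

mem : ∀ {n} → Subset n → Fin n → Bool
mem S i = lookup S i

inBrick : ∀ {n} → Subset n → Subset n → Subset n → Cell n → Set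
inBrick I J K (i , j , k) = (mem I i ≡ true) × (mem J j ≡ true) × (mem K k ≡ true)

onCommonLine : ∀ {n} → Cell n → Cell n → Set
onCommonLine (i , j , k) (i' , j' , k') =
  ((i ≡ i') × (j ≡ j')) ⊎ ((i ≡ i') × (k ≡ k')) ⊎ ((j ≡ j') × (k ≡ k'))

record MarkedBrick (n : ℕ) : Set where
  field
    I J K : Subset n
    mark  : Cell n → Mark

module _ {n : ℕ} (T : MarkedBrick n) where
  open MarkedBrick T

  mk : Fin n → Fin n → Fin n → Bool
  mk i j k = isMarked (mark (i , j , k))

  xLayerZ xLayerY : Fin n → ℕ
  xLayerZ i = count (λ σ → mem K σ ∧ anyF (λ j → mem J j ∧ mk i j σ))
  xLayerY i = count (λ j → mem J j ∧ anyF (λ σ → mem K σ ∧ mk i j σ))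

  yLayerZ yLayerX : Fin n → ℕ
  yLayerZ j = count (λ σ → mem K σ ∧ anyF (λ i → mem I i ∧ mk i j σ))
  yLayerX j = count (λ i → mem I i ∧ anyF (λ σ → mem K σ ∧ mk i j σ))

  zLayerY zLayerX : Fin n → ℕ
  zLayerY σ = count (λ j → mem J j ∧ anyF (λ i → mem I i ∧ mk i j σ))
  zLayerX σ = count (λ i → mem I i ∧ anyF (λ j → mem J j ∧ mk i j σ))

  Nx Ny Nz : Fin n → ℕ
  Nx = xLayerZ
  Ny = yLayerZ
  Nz = zLayerY

  sumNx sumNy sumNz : ℕ
  sumNx = sumF (λ i → if mem I i then Nx i else 0)
  sumNy = sumF (λ j → if mem J j then Ny j else 0)
  sumNz = sumF (λ σ → if mem K σ then Nz σ else 0)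

  potential : ℕ
  potential = sumNx

  ValidMarking : Set
  ValidMarking =
      (∀ p → mark p ≢ blank → inBrick I J K p)
    × (∀ p q → mark p ≡ rook → mark q ≡ rook → p ≢ q → ¬ onCommonLine p q)
    × (∀ p q → mark p ≡ rook → mark q ≡ dot → ¬ onCommonLine p q)

  Compact : Set
  Compact =
      ValidMarking
    × (∀ i → mem I i ≡ true → xLayerZ i ≡ xLayerY i)
    × (∀ j → mem J j ≡ true → yLayerZ j ≡ yLayerX j)
    × (∀ σ → mem K σ ≡ true → zLayerY σ ≡ zLayerX σ)
    × (sumNx ≡ sumNy)
    × (sumNy ≡ sumNz)

{-# OPTIONS --safe #-}

-- Write XY, XZ and YZ for the projections of the marked cells onto the coordinate planes and read
-- a cell (x , y , z) of the cube as "symbol z in cell (x , y)" of an n × n array. The required set R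
-- is then a partial Latin square L on the cells (x , y) outside XY whose symbol L x y lies on no
-- marked line (z ∉ XZ x, z ∉ YZ y) and lies outside K on I × J; the count n² − p₀ comes for free.
-- L is filled in three rounds, each an instance of Kőnig's edge-colouring theorem for bipartite
-- multigraphs, the colours being rows outside I, columns outside J and symbols outside K:
--  1. the symbols of K that a column of J still lacks go to rows outside I; dummy edges to symbols
--     outside K make every column of J have degree exactly n − a, and hypothesis 4 is exactly the
--     room needed for them;
--  2. the symbols of K that a row still lacks go to columns outside J;
--  3. every remaining free cell gets a symbol outside K.
-- Hypotheses 1–3 bound the degrees of the three graphs by the number of colours; in round 3 this is
-- because every row and every column already carries at least c symbols.

module Submission where

module _ where
  open import Defs
  open import Algebra.Properties.CommutativeSemigroup using (interchange)
  open import Data.Bool using (Bool; true; false; _∧_; _∨_; not; if_then_else_)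
  import Data.Bool as Bool
  open import Data.Bool.Properties using (∧-identityʳ; ∧-zeroʳ; ∧-conicalˡ; ∧-conicalʳ; ∨-zeroʳ; if-cong)
  open import Data.Empty using (⊥-elim)
  open import Data.Fin
    using (Fin; zero; suc; toℕ; fromℕ<; punchOut; _↑ˡ_; _↑ʳ_; splitAt; remQuot; combine; inject≤)
  open import Data.Fin.Permutation.Components using (transpose; transpose-inverse)
  open import Data.Fin.Properties
    using (¬Fin0; _≟_; any?; all?; suc-injective; injective⇒≤; toℕ-injective; toℕ-fromℕ<; toℕ≤pred[n];
           punchOut-injective; splitAt-↑ˡ; splitAt-↑ʳ; ↑ˡ-injective; ↑ʳ-injective; remQuot-combine;
           combine-remQuot; inject≤-injective)
  open import Data.Fin.Subset using (Subset; ∣_∣)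
  open import Data.Integer using (ℤ; +_)
  import Data.Integer as ℤ
  import Data.Integer.Properties as ℤP
  import Data.Integer.Tactic.RingSolver as ℤ-Solver
  open import Data.List using (List; length; tabulate)
  open import Data.List.Properties using (length-tabulate)
  open import Data.List.Membership.Propositional using (_∈_)
  open import Data.List.Membership.Propositional.Properties using (∈-tabulate⁻)
  open import Data.List.Relation.Unary.AllPairs using (AllPairs)
  open import Data.List.Relation.Unary.AllPairs.Properties using (tabulate⁺)
  open import Data.Maybe using (Maybe; just; nothing; _>>=_)
  import Data.Maybe.Properties as MaybeP
  open import Data.Nat using (ℕ; zero; suc; _+_; _*_; _∸_; _^_; _≤_; _<_; _<ᵇ_; z≤n; s≤s)
  open import Data.Nat.Properties
    using (+-suc; +-comm; +-assoc; +-identityʳ; *-identityʳ; +-commutativeSemigroup; ≤-trans; ≤-reflexive;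
           ≤-antisym; n≮n; m≤n+m; m≤m+n; m∸n+n≡m; +-cancelʳ-≤; +-cancelʳ-≡; +-mono-≤; +-monoˡ-≤;
           +-monoʳ-≤; module ≤-Reasoning)
  open import Data.Nat.Tactic.RingSolver using (solve-∀)
  open import Data.Product using (Σ; _×_; _,_; proj₁; proj₂; ∃; uncurry)
  open import Data.Sum using (_⊎_; inj₁; inj₂; [_,_]′)
  open import Data.Vec using ([]; _∷_)
  import Data.Vec.Functional as Vector
  open import Function using (_∘_)
  open import Relation.Nullary using (¬_; Dec; yes; no; does)
  open import Relation.Nullary.Decidable using (_×-dec_; _→-dec_; ¬?; dec-true; dec-false)
  open import Relation.Binary.PropositionalEquality
    using (_≡_; _≢_; refl; sym; trans; cong; cong₂; subst; subst₂; module ≡-Reasoning)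

  bool-absurd : ∀ {b} → b ≡ true → b ≡ false → ∀ {ℓ} {A : Set ℓ} → A
  bool-absurd refl ()

  ≢true⇒≡false : ∀ {b} → ¬ (b ≡ true) → b ≡ false
  ≢true⇒≡false {true}  h = ⊥-elim (h refl)
  ≢true⇒≡false {false} h = refl

  not≡true⇒≡false : ∀ {b} → not b ≡ true → b ≡ false
  not≡true⇒≡false {false} _ = refl

  ∧-trueˡ : ∀ {b x} → b ≡ true → b ∧ x ≡ x
  ∧-trueˡ refl = refl

  ∧-falseˡ : ∀ {b x} → b ≡ false → b ∧ x ≡ false
  ∧-falseˡ refl = refl

  bool-cases : (b : Bool) → (b ≡ true) ⊎ (b ≡ false)
  bool-cases true  = inj₁ refl
  bool-cases false = inj₂ refl

  count-cong : ∀ {N} {f g : Fin N → Bool} → (∀ k → f k ≡ g k) → count f ≡ count g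
  count-cong {zero}  eq = refl
  count-cong {suc N} eq rewrite eq zero = cong (λ r → _ + r) (count-cong (eq ∘ suc))

  count-none : ∀ {N} {f : Fin N → Bool} → (∀ k → f k ≡ false) → count f ≡ 0
  count-none {zero}  eq = refl
  count-none {suc N} eq rewrite eq zero = count-none (eq ∘ suc)

  count-all : ∀ {N} {f : Fin N → Bool} → (∀ k → f k ≡ true) → count f ≡ N
  count-all {zero}  eq = refl
  count-all {suc N} eq rewrite eq zero = cong suc (count-all (eq ∘ suc))

  count-split : ∀ {N} (f g : Fin N → Bool) →
    count f ≡ count (λ k → f k ∧ g k) + count (λ k → f k ∧ not (g k))
  count-split {zero}  f g = refl
  count-split {suc N} f g with f zero | g zero
  ... | true  | true  = cong suc (count-split (f ∘ suc) (g ∘ suc))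
  ... | true  | false = trans (cong suc (count-split (f ∘ suc) (g ∘ suc))) (sym (+-suc _ _))
  ... | false | _     = count-split (f ∘ suc) (g ∘ suc)

  count-not : ∀ {N} (f : Fin N → Bool) → count (not ∘ f) + count f ≡ N
  count-not {N} f = begin
    count (not ∘ f) + count f         ≡⟨ +-comm (count (not ∘ f)) (count f) ⟩
    count f + count (not ∘ f)         ≡⟨ count-split (λ _ → true) f ⟨
    count {N} (λ _ → true)            ≡⟨ count-all (λ _ → refl) ⟩
    N                                 ∎
    where open ≡-Reasoning

  count-∧-not : ∀ {N} (f g : Fin N → Bool) → (∀ k → g k ≡ true → f k ≡ true) →
    count (λ k → f k ∧ not (g k)) + count g ≡ count f
  count-∧-not f g g⇒f = begin
    count (λ k → f k ∧ not (g k)) + count g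
      ≡⟨ +-comm (count (λ k → f k ∧ not (g k))) (count g) ⟩
    count g + count (λ k → f k ∧ not (g k))
      ≡⟨ cong (_+ count (λ k → f k ∧ not (g k))) (count-cong (λ k → f∧g≡g k (bool-cases (g k)))) ⟨
    count (λ k → f k ∧ g k) + count (λ k → f k ∧ not (g k))
      ≡⟨ count-split f g ⟨
    count f ∎
    where
    open ≡-Reasoning
    f∧g≡g : ∀ k → (g k ≡ true) ⊎ (g k ≡ false) → f k ∧ g k ≡ g k
    f∧g≡g k (inj₁ gk) rewrite gk | g⇒f k gk = refl
    f∧g≡g k (inj₂ gk) rewrite gk = ∧-zeroʳ (f k)

  count-∨-disjoint : ∀ {N} (f g : Fin N → Bool) → (∀ k → f k ≡ true → g k ≡ false) →
    count (λ k → f k ∨ g k) ≡ count f + count g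
  count-∨-disjoint {zero}  f g disj = refl
  count-∨-disjoint {suc N} f g disj with f zero in ef | g zero in eg
  ... | true  | true  = bool-absurd eg (disj zero ef)
  ... | true  | false = cong suc (count-∨-disjoint (f ∘ suc) (g ∘ suc) (disj ∘ suc))
  ... | false | true  =
    trans (cong suc (count-∨-disjoint (f ∘ suc) (g ∘ suc) (disj ∘ suc))) (sym (+-suc _ _))
  ... | false | false = count-∨-disjoint (f ∘ suc) (g ∘ suc) (disj ∘ suc)

  count-<ᵇ : ∀ {N} r → r ≤ N → count {N} (λ s → toℕ s <ᵇ r) ≡ r
  count-<ᵇ {zero}  zero    _         = refl
  count-<ᵇ {suc N} zero    _         = count-none {N} (λ _ → refl)
  count-<ᵇ {suc N} (suc r) (s≤s r≤N) = cong suc (count-<ᵇ {N} r r≤N)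

  enum : ∀ {N} (f : Fin N → Bool) → Fin (count f) → Fin N
  enum {suc N} f i with f zero
  enum {suc N} f zero    | true  = zero
  enum {suc N} f (suc i) | true  = suc (enum (f ∘ suc) i)
  enum {suc N} f i       | false = suc (enum (f ∘ suc) i)

  rank : ∀ {N} (f : Fin N → Bool) (k : Fin N) → f k ≡ true → Fin (count f)
  rank {suc N} f zero    fk with f zero
  rank {suc N} f zero    fk  | true  = zero
  rank {suc N} f zero    ()  | false
  rank {suc N} f (suc k) fk with f zero
  ... | true  = suc (rank (f ∘ suc) k fk)
  ... | false = rank (f ∘ suc) k fk

  enum-true : ∀ {N} (f : Fin N → Bool) (i : Fin (count f)) → f (enum f i) ≡ true
  enum-true {suc N} f i with f zero in f0
  enum-true {suc N} f zero    | true  = f0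
  enum-true {suc N} f (suc i) | true  = enum-true (f ∘ suc) i
  enum-true {suc N} f i       | false = enum-true (f ∘ suc) i

  enum-injective : ∀ {N} (f : Fin N → Bool) {i j : Fin (count f)} → enum f i ≡ enum f j → i ≡ j
  enum-injective {suc N} f {i} {j} eq with f zero
  enum-injective {suc N} f {zero}  {zero}  eq | true  = refl
  enum-injective {suc N} f {suc i} {suc j} eq | true  =
    cong suc (enum-injective (f ∘ suc) (suc-injective eq))
  enum-injective {suc N} f {i}     {j}     eq | false = enum-injective (f ∘ suc) (suc-injective eq)

  enum-rank : ∀ {N} (f : Fin N → Bool) (k : Fin N) (fk : f k ≡ true) → enum f (rank f k fk) ≡ k
  enum-rank {suc N} f zero    fk with f zero
  enum-rank {suc N} f zero    fk  | true  = refl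
  enum-rank {suc N} f zero    ()  | false
  enum-rank {suc N} f (suc k) fk with f zero
  ... | true  = cong suc (enum-rank (f ∘ suc) k fk)
  ... | false = cong suc (enum-rank (f ∘ suc) k fk)

  rank-injective : ∀ {N} (f : Fin N → Bool) {k k' : Fin N} (fk : f k ≡ true) (fk' : f k' ≡ true) →
    rank f k fk ≡ rank f k' fk' → k ≡ k'
  rank-injective f {k} {k'} fk fk' eq =
    trans (sym (enum-rank f k fk)) (trans (cong (enum f) eq) (enum-rank f k' fk'))

  count-enum : ∀ {N} (f g : Fin N → Bool) → count (g ∘ enum f) ≡ count (λ k → f k ∧ g k)
  count-enum {zero}  f g = refl
  count-enum {suc N} f g with f zero
  ... | true  = cong (λ r → _ + r) (count-enum (f ∘ suc) (g ∘ suc))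
  ... | false = count-enum (f ∘ suc) (g ∘ suc)

  count≤-injection : ∀ {N M} (f : Fin N → Bool) (φ : (k : Fin N) → f k ≡ true → Fin M) →
    (∀ {k k'} fk fk' → φ k fk ≡ φ k' fk' → k ≡ k') → count f ≤ M
  count≤-injection f φ φ-inj =
    injective⇒≤ {f = λ i → φ (enum f i) (enum-true f i)} (enum-injective f ∘ φ-inj _ _)

  count-mono-injection : ∀ {N M} (f : Fin N → Bool) (g : Fin M → Bool)
    (φ : (k : Fin N) → f k ≡ true → Fin M) → (∀ k fk → g (φ k fk) ≡ true) →
    (∀ {k k'} fk fk' → φ k fk ≡ φ k' fk' → k ≡ k') → count f ≤ count g
  count-mono-injection f g φ φ-g φ-inj =
    count≤-injection f (λ k fk → rank g (φ k fk) (φ-g k fk))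
      (λ fk fk' eq → φ-inj fk fk' (rank-injective g _ _ eq))

  count-mono : ∀ {N} (f g : Fin N → Bool) → (∀ k → f k ≡ true → g k ≡ true) → count f ≤ count g
  count-mono f g f⇒g = count-mono-injection f g (λ k _ → k) f⇒g (λ _ _ eq → eq)

  sumF-+ : ∀ {N} (f g : Fin N → ℕ) → sumF (λ k → f k + g k) ≡ sumF f + sumF g
  sumF-+ {zero}  f g = refl
  sumF-+ {suc N} f g rewrite sumF-+ (f ∘ suc) (g ∘ suc) =
    interchange +-commutativeSemigroup (f zero) (g zero) _ _

  sumF-cong : ∀ {N} {f g : Fin N → ℕ} → (∀ k → f k ≡ g k) → sumF f ≡ sumF g
  sumF-cong {zero}  eq = refl
  sumF-cong {suc N} eq rewrite eq zero = cong (λ r → _ + r) (sumF-cong (eq ∘ suc))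

  sumF-zero : ∀ {N} {f : Fin N → ℕ} → (∀ k → f k ≡ 0) → sumF f ≡ 0
  sumF-zero {zero}  eq = refl
  sumF-zero {suc N} eq rewrite eq zero = sumF-zero (eq ∘ suc)

  sumF-const : ∀ {N} (c : ℕ) → sumF {N} (λ _ → c) ≡ N * c
  sumF-const {zero}  c = refl
  sumF-const {suc N} c = cong (λ r → c + r) (sumF-const {N} c)

  sumF-if : ∀ {N} (f : Fin N → Bool) (c : ℕ) → sumF (λ k → if f k then c else 0) ≡ count f * c
  sumF-if {zero}  f c = refl
  sumF-if {suc N} f c with f zero
  ... | true  = cong (λ r → c + r) (sumF-if (f ∘ suc) c)
  ... | false = sumF-if (f ∘ suc) c

  sumF-count-comm : ∀ {N M} (P : Fin N → Fin M → Bool) →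
    sumF (λ i → count (P i)) ≡ sumF (λ j → count (λ i → P i j))
  sumF-count-comm {zero} {M} P = sym (sumF-zero {M} (λ _ → refl))
  sumF-count-comm {suc N} P = begin
    count (P zero) + sumF (λ i → count (P (suc i)))
      ≡⟨ cong₂ _+_ (trans (sumF-if (P zero) 1) (*-identityʳ _)) (sym (sumF-count-comm (P ∘ suc))) ⟨
    sumF (λ j → if P zero j then 1 else 0) + sumF (λ j → count (λ i → P (suc i) j))
      ≡⟨ sumF-+ (λ j → if P zero j then 1 else 0) (λ j → count (λ i → P (suc i) j)) ⟨
    sumF (λ j → count (λ i → P i j)) ∎
    where open ≡-Reasoning

  difference-bound : ∀ {x y s t u n} → x + y ≡ s → t + s ≤ y + n → u + t ≡ n → x ≤ u
  difference-bound {x} {y} {t = t} {u} refl bound refl =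
    +-cancelʳ-≤ (t + y) x u (subst₂ _≤_ (shuffle t x y) (shuffle' y u t) bound)
    where
    shuffle : ∀ t x y → t + (x + y) ≡ x + (t + y)
    shuffle = solve-∀
    shuffle' : ∀ y u t → y + (u + t) ≡ u + (t + y)
    shuffle' = solve-∀

  dec-witness : ∀ {ℓ} {A : Set ℓ} (a? : Dec A) → does a? ≡ true → A
  dec-witness (yes a) _ = a

  _≟ᵇ_ : ∀ {n} → Fin n → Fin n → Bool
  x ≟ᵇ y = does (x ≟ y)

  ≟ᵇ⇒≡ : ∀ {n} {x y : Fin n} → x ≟ᵇ y ≡ true → x ≡ y
  ≟ᵇ⇒≡ {x = x} {y} = dec-witness (x ≟ y)

  ≡⇒≟ᵇ : ∀ {n} {x y : Fin n} → x ≡ y → x ≟ᵇ y ≡ true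
  ≡⇒≟ᵇ {x = x} {y} = dec-true (x ≟ y)

  ≟ᵇ-refl : ∀ {n} (x : Fin n) → (if x ≟ᵇ x then 1 else 0) ≡ 1
  ≟ᵇ-refl x rewrite ≡⇒≟ᵇ (refl {x = x}) = refl

  ≟ᵇ-injective : ∀ {n k} (f : Fin n → Fin k) → (∀ {u v} → f u ≡ f v → u ≡ v) →
    ∀ u v → f u ≟ᵇ f v ≡ u ≟ᵇ v
  ≟ᵇ-injective f f-inj u v with f u ≟ f v | u ≟ v
  ... | yes _    | yes _   = refl
  ... | no _     | no _    = refl
  ... | yes fu≡fv | no u≢v  = ⊥-elim (u≢v (f-inj fu≡fv))
  ... | no fu≢fv | yes u≡v = ⊥-elim (fu≢fv (cong f u≡v))

  missing-colour : ∀ {m Δ} (A : Fin m → Bool) (col : Fin m → Fin Δ) → count A < Δ →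
    ∃ λ α → ∀ k → A k ≡ true → col k ≢ α
  missing-colour {m} {Δ} A col A<Δ with any? (λ α → ¬? (present? α))
    where
    present? : (α : Fin Δ) → Dec (∃ λ k → A k ≡ true × col k ≡ α)
    present? α = any? (λ k → (A k Bool.≟ true) ×-dec (col k ≟ α))
  ... | yes (α , absent) = α , λ k Ak colk≡α → absent (k , Ak , colk≡α)
  ... | no ¬absent = ⊥-elim (n≮n _ (≤-trans A<Δ (injective⇒≤ {f = witness-rank} witness-rank-injective)))
    where
    witness : (α : Fin Δ) → ∃ λ k → A k ≡ true × col k ≡ α
    witness α with any? (λ k → (A k Bool.≟ true) ×-dec (col k ≟ α))
    ... | yes w = w
    ... | no ¬w = ⊥-elim (¬absent (α , ¬w))
    witness-rank : Fin Δ → Fin (count A)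
    witness-rank α = rank A (proj₁ (witness α)) (proj₁ (proj₂ (witness α)))
    witness-rank-injective : ∀ {α α'} → witness-rank α ≡ witness-rank α' → α ≡ α'
    witness-rank-injective {α} {α'} eq = trans (sym (proj₂ (proj₂ (witness α))))
      (trans (cong col (rank-injective A _ _ eq)) (proj₂ (proj₂ (witness α'))))

  all-colours-present : ∀ {m Δ} (A : Fin m → Bool) (col : Fin m → Fin Δ) →
    (∀ {k k'} → A k ≡ true → A k' ≡ true → col k ≡ col k' → k ≡ k') → count A ≡ Δ →
    ∀ γ → ∃ λ k → A k ≡ true × col k ≡ γ
  all-colours-present {m} {suc Δ} A col col-inj A≡Δ γ with any? (λ k → (A k Bool.≟ true) ×-dec (col k ≟ γ))
  ... | yes w = w
  ... | no ¬w = ⊥-elim (n≮n _ (subst (_≤ Δ) A≡Δ (count≤-injection A punched punched-injective)))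
    where
    punched : (k : Fin m) → A k ≡ true → Fin Δ
    punched k Ak = punchOut {i = γ} {j = col k} (λ γ≡colk → ¬w (k , Ak , sym γ≡colk))
    punched-injective : ∀ {k k'} Ak Ak' → punched k Ak ≡ punched k' Ak' → k ≡ k'
    punched-injective Ak Ak' eq = col-inj Ak Ak' (punchOut-injective {i = γ} _ _ eq)

  module _ {m p q : ℕ} (E : Fin m → Fin p × Fin q) where

    degˡ : Fin p → ℕ
    degˡ x = count (λ k → proj₁ (E k) ≟ᵇ x)

    degʳ : Fin q → ℕ
    degʳ y = count (λ k → proj₂ (E k) ≟ᵇ y)

    Adjacent : Fin m → Fin m → Set
    Adjacent k k' = (proj₁ (E k) ≡ proj₁ (E k')) ⊎ (proj₂ (E k) ≡ proj₂ (E k'))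

    ProperColouring : ∀ {Δ} → (Fin m → Fin Δ) → Set
    ProperColouring col = ∀ {k k'} → k ≢ k' → Adjacent k k' → col k ≢ col k'

    proper-unique : ∀ {Δ} {col : Fin m → Fin Δ} → ProperColouring col →
      ∀ {k k'} → Adjacent k k' → col k ≡ col k' → k ≡ k'
    proper-unique proper {k} {k'} adj same with k ≟ k'
    ... | yes k≡k' = k≡k'
    ... | no k≢k'  = ⊥-elim (proper k≢k' adj same)

    Adjacent-sym : ∀ {k k'} → Adjacent k k' → Adjacent k' k
    Adjacent-sym (inj₁ eq) = inj₁ (sym eq)
    Adjacent-sym (inj₂ eq) = inj₂ (sym eq)

    colour-at-full-left : ∀ {Δ} {col : Fin m → Fin Δ} → ProperColouring col →
      ∀ x → degˡ x ≡ Δ → ∀ γ → ∃ λ k → proj₁ (E k) ≡ x × col k ≡ γ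
    colour-at-full-left proper x full γ with all-colours-present _ _
        (λ hk hk' → proper-unique proper (inj₁ (trans (≟ᵇ⇒≡ hk) (sym (≟ᵇ⇒≡ hk'))))) full γ
    ... | k , hk , colk = k , ≟ᵇ⇒≡ hk , colk

    colour-at-full-right : ∀ {Δ} {col : Fin m → Fin Δ} → ProperColouring col →
      ∀ y → degʳ y ≡ Δ → ∀ γ → ∃ λ k → proj₂ (E k) ≡ y × col k ≡ γ
    colour-at-full-right proper y full γ with all-colours-present _ _
        (λ hk hk' → proper-unique proper (inj₂ (trans (≟ᵇ⇒≡ hk) (sym (≟ᵇ⇒≡ hk'))))) full γ
    ... | k , hk , colk = k , ≟ᵇ⇒≡ hk , colk

    -- The α/β Kempe chain through the right vertex v: it starts with the α-edge at v and
    -- alternately continues through left endpoints (to a β-edge) and right endpoints (to an α-edge).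
    module KempeSwap {Δ} (col : Fin m → Fin Δ) (proper : ProperColouring col)
      (α β : Fin Δ) (α≢β : α ≢ β) (u : Fin p) (v : Fin q)
      (α∉u : ∀ k → proj₁ (E k) ≡ u → col k ≢ α) (β∉v : ∀ k → proj₂ (E k) ≡ v → col k ≢ β) where

      first : ∀ {P : Fin m → Set} → Dec (∃ P) → Maybe (Fin m)
      first (yes (k , _)) = just k
      first (no _)        = nothing

      first-sound : ∀ {P : Fin m → Set} (d : Dec (∃ P)) {k} → first d ≡ just k → P k
      first-sound (yes (k , Pk)) refl = Pk

      first-complete : ∀ {P : Fin m → Set} (d : Dec (∃ P)) {k} → P k → ∃ λ k' → first d ≡ just k'
      first-complete (yes (k' , _)) _  = k' , refl
      first-complete (no ¬∃P)       Pk = ⊥-elim (¬∃P (_ , Pk))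

      αEdgeAt : Fin q → Maybe (Fin m)
      αEdgeAt y = first (any? (λ k → (proj₂ (E k) ≟ y) ×-dec (col k ≟ α)))

      βEdgeAt : Fin p → Maybe (Fin m)
      βEdgeAt x = first (any? (λ k → (proj₁ (E k) ≟ x) ×-dec (col k ≟ β)))

      αEdgeAt-sound : ∀ {y k} → αEdgeAt y ≡ just k → proj₂ (E k) ≡ y × col k ≡ α
      αEdgeAt-sound = first-sound (any? _)

      βEdgeAt-sound : ∀ {x k} → βEdgeAt x ≡ just k → proj₁ (E k) ≡ x × col k ≡ β
      βEdgeAt-sound = first-sound (any? _)

      αEdgeAt-complete : ∀ {k} → col k ≡ α → αEdgeAt (proj₂ (E k)) ≡ just k
      αEdgeAt-complete {k} colk with first-complete
          (any? (λ k' → (proj₂ (E k') ≟ proj₂ (E k)) ×-dec (col k' ≟ α))) (refl , colk)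
      ... | k' , found with αEdgeAt-sound found
      ... | endpoint , colk' = trans found (cong just
          (proper-unique proper (inj₂ endpoint) (trans colk' (sym colk))))

      βEdgeAt-complete : ∀ {k} → col k ≡ β → βEdgeAt (proj₁ (E k)) ≡ just k
      βEdgeAt-complete {k} colk with first-complete
          (any? (λ k' → (proj₁ (E k') ≟ proj₁ (E k)) ×-dec (col k' ≟ β))) (refl , colk)
      ... | k' , found with βEdgeAt-sound found
      ... | endpoint , colk' = trans found (cong just
          (proper-unique proper (inj₁ endpoint) (trans colk' (sym colk))))

      data Link (k k' : Fin m) : Set where
        viaLeft  : col k ≡ α → col k' ≡ β → proj₁ (E k) ≡ proj₁ (E k') → Link k k'
        viaRight : col k ≡ β → col k' ≡ α → proj₂ (E k) ≡ proj₂ (E k') → Link k k'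

      step : Fin m → Maybe (Fin m)
      step k with col k ≟ α
      ... | yes _ = βEdgeAt (proj₁ (E k))
      ... | no _  = αEdgeAt (proj₂ (E k))

      step-sound : ∀ {k k'} → col k ≡ α ⊎ col k ≡ β → step k ≡ just k' → Link k k'
      step-sound {k} colk found with col k ≟ α | colk
      ... | yes colk≡α | _ = viaLeft colk≡α (proj₂ (βEdgeAt-sound found)) (sym (proj₁ (βEdgeAt-sound found)))
      ... | no colk≢α | inj₁ colk≡α = ⊥-elim (colk≢α colk≡α)
      ... | no _      | inj₂ colk≡β = viaRight colk≡β (proj₂ (αEdgeAt-sound found))
          (sym (proj₁ (αEdgeAt-sound found)))

      step-complete : ∀ {k k'} → Link k k' → step k ≡ just k'
      step-complete {k} (viaLeft colk colk' shared) with col k ≟ α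
      ... | yes _ = trans (cong βEdgeAt shared) (βEdgeAt-complete colk')
      ... | no colk≢α = ⊥-elim (colk≢α colk)
      step-complete {k} (viaRight colk colk' shared) with col k ≟ α
      ... | yes colk≡α = ⊥-elim (α≢β (trans (sym colk≡α) colk))
      ... | no _ = trans (cong αEdgeAt shared) (αEdgeAt-complete colk')

      chain : ℕ → Maybe (Fin m)
      chain zero    = αEdgeAt v
      chain (suc t) = chain t >>= step

      chain-step : ∀ t {k k'} → chain t ≡ just k → step k ≡ just k' → chain (suc t) ≡ just k'
      chain-step t found next rewrite found = next

      chain-colour : ∀ t {k} → chain t ≡ just k → col k ≡ α ⊎ col k ≡ β
      chain-colour zero found = inj₁ (proj₂ (αEdgeAt-sound found))
      chain-colour (suc t) found with chain t in eq
      ... | just k with step-sound (chain-colour t eq) found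
      ...   | viaLeft  _ colk' _ = inj₂ colk'
      ...   | viaRight _ colk' _ = inj₁ colk'

      chain-link : ∀ t {k'} → chain (suc t) ≡ just k' → ∃ λ k → chain t ≡ just k × Link k k'
      chain-link t found with chain t in eq
      ... | just k = k , refl , step-sound (chain-colour t eq) found

      start-has-no-link : ∀ {k k₀} → chain zero ≡ just k₀ → ¬ Link k k₀
      start-has-no-link found (viaLeft _ colk₀ _) = α≢β (trans (sym (proj₂ (αEdgeAt-sound found))) colk₀)
      start-has-no-link {k} found (viaRight colk _ shared) = β∉v k
          (trans shared (proj₁ (αEdgeAt-sound found))) colk

      link-unique : ∀ {k₁ k₂ k} → Link k₁ k → Link k₂ k → k₁ ≡ k₂
      link-unique (viaLeft c₁ _ s₁) (viaLeft c₂ _ s₂) = proper-unique proper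
          (inj₁ (trans s₁ (sym s₂))) (trans c₁ (sym c₂))
      link-unique (viaRight c₁ _ s₁) (viaRight c₂ _ s₂) = proper-unique proper
          (inj₂ (trans s₁ (sym s₂))) (trans c₁ (sym c₂))
      link-unique (viaLeft _ colk _) (viaRight _ colk' _) = ⊥-elim (α≢β (trans (sym colk') colk))
      link-unique (viaRight _ colk _) (viaLeft _ colk' _) = ⊥-elim (α≢β (trans (sym colk) colk'))

      chain-injective : ∀ i j {k} → chain i ≡ just k → chain j ≡ just k → i ≡ j
      chain-injective zero    zero    _  _  = refl
      chain-injective zero    (suc j) ci cj = ⊥-elim (start-has-no-link ci (proj₂ (proj₂ (chain-link j cj))))
      chain-injective (suc i) zero    ci cj = ⊥-elim (start-has-no-link cj (proj₂ (proj₂ (chain-link i ci))))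
      chain-injective (suc i) (suc j) ci cj with chain-link i ci | chain-link j cj
      ... | k₁ , c₁ , l₁ | k₂ , c₂ , l₂ =
        cong suc (chain-injective i j c₁ (subst (λ k → chain j ≡ just k) (sym (link-unique l₁ l₂)) c₂))

      chain-defined-before : ∀ d s {k} → chain (d + s) ≡ just k → ∃ λ k' → chain s ≡ just k'
      chain-defined-before zero    s found = _ , found
      chain-defined-before (suc d) s found = chain-defined-before d s (proj₁ (proj₂ (chain-link (d + s) found)))

      chain-length : ∀ t {k} → chain t ≡ just k → t < m
      chain-length t {k} found = injective⇒≤ {f = λ s → proj₁ (defined s)} defined-injective
        where
        defined : (s : Fin (suc t)) → ∃ λ k' → chain (toℕ s) ≡ just k'
        defined s = chain-defined-before (t ∸ toℕ s) (toℕ s)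
          (subst (λ r → chain r ≡ just k) (sym (m∸n+n≡m (toℕ≤pred[n] s))) found)
        defined-injective : ∀ {s s'} → proj₁ (defined s) ≡ proj₁ (defined s') → s ≡ s'
        defined-injective {s} {s'} eq = toℕ-injective (chain-injective (toℕ s) (toℕ s') (proj₂ (defined s))
          (subst (λ k' → chain (toℕ s') ≡ just k') (sym eq) (proj₂ (defined s'))))

      inChain? : (k : Fin m) → Dec (∃ λ (t : Fin m) → chain (toℕ t) ≡ just k)
      inChain? k = any? (λ t → MaybeP.≡-dec _≟_ (chain (toℕ t)) (just k))

      InChain : Fin m → Set
      InChain k = ∃ λ t → chain t ≡ just k

      inChain : Fin m → Bool
      inChain k = does (inChain? k)

      inChain-intro : ∀ {k} → InChain k → inChain k ≡ true
      inChain-intro {k} (t , found) = dec-true (inChain? k)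
        (fromℕ< (chain-length t found) , subst (λ r → chain r ≡ just k)
            (sym (toℕ-fromℕ< (chain-length t found))) found)

      inChain-elim : ∀ {k} → inChain k ≡ true → InChain k
      inChain-elim {k} h with dec-witness (inChain? k) h
      ... | t , found = toℕ t , found

      chain-closed : ∀ {k k'} → InChain k → Link k k' ⊎ Link k' k → InChain k'
      chain-closed (t , found) (inj₁ link) = suc t , chain-step t found (step-complete link)
      chain-closed (zero , found) (inj₂ link) = ⊥-elim (start-has-no-link found link)
      chain-closed (suc t , found) (inj₂ link) with chain-link t found
      ... | k₀ , found₀ , link₀ = t , subst (λ k → chain t ≡ just k) (link-unique link₀ link) found₀

      swap : Fin Δ → Fin Δ
      swap = transpose α β

      swap-α : swap α ≡ β
      swap-α rewrite dec-true (α ≟ α) refl = refl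

      swap-β : swap β ≡ α
      swap-β rewrite dec-false (β ≟ α) (α≢β ∘ sym) | dec-true (β ≟ β) refl = refl

      swap-injective : ∀ {c c'} → swap c ≡ swap c' → c ≡ c'
      swap-injective {c} {c'} eq =
        trans (sym (transpose-inverse β α)) (trans (cong (transpose β α) eq) (transpose-inverse β α))

      swapped-link : ∀ {k k'} → col k ≡ α ⊎ col k ≡ β → Adjacent k k' → col k' ≡ swap (col k) →
        Link k k' ⊎ Link k' k
      swapped-link (inj₁ colk) (inj₁ shared) colk' = inj₁
          (viaLeft colk (trans colk' (trans (cong swap colk) swap-α)) shared)
      swapped-link (inj₁ colk) (inj₂ shared) colk' = inj₂
          (viaRight (trans colk' (trans (cong swap colk) swap-α)) colk (sym shared))
      swapped-link (inj₂ colk) (inj₁ shared) colk' = inj₂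
          (viaLeft (trans colk' (trans (cong swap colk) swap-β)) colk (sym shared))
      swapped-link (inj₂ colk) (inj₂ shared) colk' = inj₁
          (viaRight colk (trans colk' (trans (cong swap colk) swap-β)) shared)

      col' : Fin m → Fin Δ
      col' k = if inChain k then swap (col k) else col k

      col'-in : ∀ {k} → inChain k ≡ true → col' k ≡ swap (col k)
      col'-in h rewrite h = refl

      col'-out : ∀ {k} → inChain k ≡ false → col' k ≡ col k
      col'-out h rewrite h = refl

      boundary-proper : ∀ {k k'} → inChain k ≡ true → inChain k' ≡ false → Adjacent k k' → col' k ≢ col' k'
      boundary-proper {k} in-k out-k' adj same with inChain-elim in-k
      ... | t , found = bool-absurd (inChain-intro (chain-closed (t , found)
            (swapped-link (chain-colour t found) adj
                (trans (sym (col'-out out-k')) (trans (sym same) (col'-in in-k))))))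
            out-k'

      proper' : ProperColouring col'
      proper' {k} {k'} k≢k' adj same with bool-cases (inChain k) | bool-cases (inChain k')
      ... | inj₁ in-k  | inj₁ in-k'  = proper k≢k' adj
          (swap-injective (trans (sym (col'-in in-k)) (trans same (col'-in in-k'))))
      ... | inj₁ in-k  | inj₂ out-k' = boundary-proper in-k out-k' adj same
      ... | inj₂ out-k | inj₁ in-k'  = boundary-proper in-k' out-k (Adjacent-sym adj) (sym same)
      ... | inj₂ out-k | inj₂ out-k' = proper k≢k' adj
          (trans (sym (col'-out out-k)) (trans same (col'-out out-k')))

      α∉u' : ∀ k → proj₁ (E k) ≡ u → col' k ≢ α
      α∉u' k atu colk' with bool-cases (inChain k)
      ... | inj₂ out-k = α∉u k atu (trans (sym (col'-out out-k)) colk')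
      ... | inj₁ in-k with inChain-elim in-k
      ... | t , found with chain-colour t found
      ... | inj₁ colk = α≢β (trans (sym colk') (trans (col'-in in-k) (trans (cong swap colk) swap-α)))
      ... | inj₂ colk with t
      ... | zero   = α≢β (trans (sym (proj₂ (αEdgeAt-sound found))) colk)
      ... | suc t' with chain-link t' found
      ... | k₀ , _ , viaLeft colk₀ _ shared = α∉u k₀ (trans shared atu) colk₀
      ... | k₀ , _ , viaRight _ colk≡α _ = α≢β (trans (sym colk≡α) colk)

      α∉v' : ∀ k → proj₂ (E k) ≡ v → col' k ≢ α
      α∉v' k atv colk' with bool-cases (inChain k)
      ... | inj₂ out-k = bool-absurd (inChain-intro (zero , αEdgeAt-complete-at)) out-k
        where
        αEdgeAt-complete-at : αEdgeAt v ≡ just k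
        αEdgeAt-complete-at = subst (λ y → αEdgeAt y ≡ just k) atv
            (αEdgeAt-complete (trans (sym (col'-out out-k)) colk'))
      ... | inj₁ in-k with inChain-elim in-k
      ... | t , found with chain-colour t found
      ... | inj₁ colk = α≢β (trans (sym colk') (trans (col'-in in-k) (trans (cong swap colk) swap-α)))
      ... | inj₂ colk = β∉v k atv colk

  extend-colouring : ∀ {m p q Δ} (E : Fin (suc m) → Fin p × Fin q) (col : Fin m → Fin Δ) (α : Fin Δ) →
    ProperColouring (E ∘ suc) col →
    (∀ k → proj₁ (E (suc k)) ≡ proj₁ (E zero) → col k ≢ α) →
    (∀ k → proj₂ (E (suc k)) ≡ proj₂ (E zero) → col k ≢ α) →
    ProperColouring E (α Vector.∷ col)
  extend-colouring E col α proper α∉x α∉y {zero}  {zero}   k≢k' _ = ⊥-elim (k≢k' refl)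
  extend-colouring E col α proper α∉x α∉y {zero}  {suc k'} _ (inj₁ shared) eq = α∉x k' (sym shared) (sym eq)
  extend-colouring E col α proper α∉x α∉y {zero}  {suc k'} _ (inj₂ shared) eq = α∉y k' (sym shared) (sym eq)
  extend-colouring E col α proper α∉x α∉y {suc k} {zero}   _ (inj₁ shared) eq = α∉x k shared eq
  extend-colouring E col α proper α∉x α∉y {suc k} {zero}   _ (inj₂ shared) eq = α∉y k shared eq
  extend-colouring E col α proper α∉x α∉y {suc k} {suc k'} k≢k' adj eq = proper (k≢k' ∘ cong suc) adj eq

  -- The new edge (u, v) sees a colour α missing at u and β missing at v; if α is also missing at v
  -- it is used directly, otherwise the α/β Kempe chain from v is swapped, which frees α at v
  -- without occupying it at u.
  konig : ∀ {p q} Δ m (E : Fin m → Fin p × Fin q) → (∀ x → degˡ E x ≤ Δ) → (∀ y → degʳ E y ≤ Δ) →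
    Σ (Fin m → Fin Δ) (ProperColouring E)
  konig Δ zero    E _ _ = (λ ()) , λ {k} → ⊥-elim (¬Fin0 k)
  konig Δ (suc m) E degˡ≤ degʳ≤ with konig Δ m (E ∘ suc) (λ x → ≤-trans (m≤n+m _ _) (degˡ≤ x))
                                                         (λ y → ≤-trans (m≤n+m _ _) (degʳ≤ y))
  ... | col , proper = result
    where
    u = proj₁ (E zero)
    v = proj₂ (E zero)
    missing-at-u = missing-colour (λ k → proj₁ (E (suc k)) ≟ᵇ u) col
        (subst (λ d → d + degˡ (E ∘ suc) u ≤ Δ) (≟ᵇ-refl u) (degˡ≤ u))
    missing-at-v = missing-colour (λ k → proj₂ (E (suc k)) ≟ᵇ v) col
        (subst (λ d → d + degʳ (E ∘ suc) v ≤ Δ) (≟ᵇ-refl v) (degʳ≤ v))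
    α = proj₁ missing-at-u
    β = proj₁ missing-at-v
    α∉u : ∀ k → proj₁ (E (suc k)) ≡ u → col k ≢ α
    α∉u k atu = proj₂ missing-at-u k (≡⇒≟ᵇ atu)
    β∉v : ∀ k → proj₂ (E (suc k)) ≡ v → col k ≢ β
    β∉v k atv = proj₂ missing-at-v k (≡⇒≟ᵇ atv)
    result : Σ (Fin (suc m) → Fin Δ) (ProperColouring E)
    result with all? (λ k → (proj₂ (E (suc k)) ≟ v) →-dec ¬? (col k ≟ α))
    ... | yes α∉v = α Vector.∷ col , extend-colouring E col α proper α∉u α∉v
    ... | no α∈v = α Vector.∷ K.col' , extend-colouring E K.col' α K.proper' K.α∉u' K.α∉v'
      where
      α≢β : α ≢ β
      α≢β α≡β = α∈v (λ k atv colk≡α → β∉v k atv (trans colk≡α α≡β))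
      module K = KempeSwap (E ∘ suc) col proper α β α≢β u v α∉u β∉v

  Adjacent-transport : ∀ {m m' p q} (E : Fin m → Fin p × Fin q) (E' : Fin m' → Fin p × Fin q) {k l k' l'} →
    E k ≡ E' k' → E l ≡ E' l' → Adjacent E' k' l' → Adjacent E k l
  Adjacent-transport E E' eqk eql (inj₁ shared) = inj₁
      (trans (cong proj₁ eqk) (trans shared (sym (cong proj₁ eql))))
  Adjacent-transport E E' eqk eql (inj₂ shared) = inj₂
      (trans (cong proj₂ eqk) (trans shared (sym (cong proj₂ eql))))

  count-↑ : ∀ {A B} (f : Fin (A + B) → Bool) → count f ≡ count (f ∘ (_↑ˡ B)) + count (f ∘ (A ↑ʳ_))
  count-↑ {zero}      f = refl
  count-↑ {suc A} {B} f =
    trans (cong (λ r → (if f zero then 1 else 0) + r) (count-↑ {A} {B} (f ∘ suc)))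
        (sym (+-assoc (if f zero then 1 else 0) _ _))

  remQuot-↑ˡ : ∀ {a} b (j : Fin b) → remQuot {suc a} b (j ↑ˡ (a * b)) ≡ (zero , j)
  remQuot-↑ˡ {a} b j = remQuot-combine zero j

  remQuot-↑ʳ : ∀ {a} b (t : Fin (a * b)) →
    remQuot {suc a} b (b ↑ʳ t) ≡ (suc (proj₁ (remQuot {a} b t)) , proj₂ (remQuot {a} b t))
  remQuot-↑ʳ {a} b t = trans (cong (remQuot {suc a} b) (cong (b ↑ʳ_) (sym (combine-remQuot {a} b t))))
                             (remQuot-combine (suc (proj₁ (remQuot {a} b t))) (proj₂ (remQuot {a} b t)))

  count-remQuot : ∀ {a b} (F : Fin a × Fin b → Bool) →
    count (F ∘ remQuot {a} b) ≡ sumF (λ i → count (λ j → F (i , j)))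
  count-remQuot {zero}      F = refl
  count-remQuot {suc a} {b} F = begin
    count (F ∘ remQuot {suc a} b)
      ≡⟨ count-↑ {b} {a * b} _ ⟩
    count (F ∘ remQuot {suc a} b ∘ (_↑ˡ (a * b))) + count (F ∘ remQuot {suc a} b ∘ (b ↑ʳ_))
      ≡⟨ cong₂ _+_ (count-cong (cong F ∘ remQuot-↑ˡ b)) (count-cong (cong F ∘ remQuot-↑ʳ b)) ⟩
    count (λ j → F (zero , j)) + count (λ t → F (suc (proj₁ (remQuot {a} b t)) , proj₂ (remQuot {a} b t)))
      ≡⟨ cong (λ r → count (λ j → F (zero , j)) + r) (count-remQuot {a} {b} (λ (i , j) → F (suc i , j))) ⟩
    count (λ j → F (zero , j)) + sumF (λ i → count (λ j → F (suc i , j))) ∎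
    where open ≡-Reasoning

  sumF-≟ᵇ : ∀ {N} (g : Fin N → ℕ) (i₀ : Fin N) → sumF (λ i → if i ≟ᵇ i₀ then g i else 0) ≡ g i₀
  sumF-≟ᵇ {suc N} g zero     = trans (cong (λ r → g zero + r) (sumF-zero {N} (λ _ → refl))) (+-identityʳ _)
  sumF-≟ᵇ {suc N} g (suc i₀) = sumF-≟ᵇ (g ∘ suc) i₀

  count-∧-const : ∀ {N} (f : Fin N → Bool) (b : Bool) → count (λ j → f j ∧ b) ≡ (if b then count f else 0)
  count-∧-const f true  = count-cong (λ j → ∧-identityʳ (f j))
  count-∧-const f false = count-none (λ j → ∧-zeroʳ (f j))

  sumF-count-≟ᵇˡ : ∀ {a b} (P : Fin a → Fin b → Bool) (i₀ : Fin a) →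
    sumF (λ i → count (λ j → P i j ∧ (i ≟ᵇ i₀))) ≡ count (P i₀)
  sumF-count-≟ᵇˡ P i₀ = trans (sumF-cong (λ i → count-∧-const (P i) (i ≟ᵇ i₀))) (sumF-≟ᵇ (count ∘ P) i₀)

  sumF-count-≟ᵇʳ : ∀ {a b} (P : Fin a → Fin b → Bool) (j₀ : Fin b) →
    sumF (λ i → count (λ j → P i j ∧ (j ≟ᵇ j₀))) ≡ count (λ i → P i j₀)
  sumF-count-≟ᵇʳ P j₀ = trans (sumF-count-comm (λ i j → P i j ∧ (j ≟ᵇ j₀))) (sumF-count-≟ᵇˡ (λ j i → P i j) j₀)

  module RelationEdges {p q : ℕ} (P : Fin p → Fin q → Bool) where

    P̂ : Fin (p * q) → Bool
    P̂ = uncurry P ∘ remQuot q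

    size : ℕ
    size = count P̂

    edge : Fin size → Fin p × Fin q
    edge = remQuot q ∘ enum P̂

    edge-related : ∀ i → uncurry P (edge i) ≡ true
    edge-related = enum-true P̂

    edge-injective : ∀ {i j} → edge i ≡ edge j → i ≡ j
    edge-injective {i} {j} eq = enum-injective P̂
      (trans (sym (combine-remQuot {p} q (enum P̂ i)))
          (trans (cong (uncurry combine) eq) (combine-remQuot {p} q (enum P̂ j))))

    index : ∀ x y → P x y ≡ true → Fin size
    index x y Pxy = rank P̂ (combine x y) (subst (λ e → uncurry P e ≡ true) (sym (remQuot-combine x y)) Pxy)

    edge-index : ∀ x y Pxy → edge (index x y Pxy) ≡ (x , y)
    edge-index x y Pxy = trans (cong (remQuot q) (enum-rank P̂ _ _)) (remQuot-combine x y)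

    index-adjacent : ∀ {x y y'} (Pxy : P x y ≡ true) (Pxy' : P x y' ≡ true) →
      Adjacent edge (index x y Pxy) (index x y' Pxy')
    index-adjacent {x} {y} {y'} Pxy Pxy' =
      inj₁ (trans (cong proj₁ (edge-index x y Pxy)) (sym (cong proj₁ (edge-index x y' Pxy'))))

    index-injective : ∀ {x y y'} (Pxy : P x y ≡ true) (Pxy' : P x y' ≡ true) →
      index x y Pxy ≡ index x y' Pxy' → y ≡ y'
    index-injective {x} {y} {y'} Pxy Pxy' eq = trans (sym (cong proj₂ (edge-index x y Pxy)))
      (trans (cong (proj₂ ∘ edge) eq) (cong proj₂ (edge-index x y' Pxy')))

    count-edge : ∀ (Q : Fin p × Fin q → Bool) → count (Q ∘ edge) ≡ sumF (λ x → count (λ y → P x y ∧ Q (x , y)))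
    count-edge Q = trans (count-enum P̂ (Q ∘ remQuot q)) (count-remQuot (λ e → uncurry P e ∧ Q e))

    degˡ-edge : ∀ x → degˡ edge x ≡ count (P x)
    degˡ-edge x = trans (count-edge (λ e → proj₁ e ≟ᵇ x)) (sumF-count-≟ᵇˡ P x)

    degʳ-edge : ∀ y → degʳ edge y ≡ count (λ x → P x y)
    degʳ-edge y = trans (count-edge (λ e → proj₂ e ≟ᵇ y)) (sumF-count-≟ᵇʳ P y)

    size-sumF : size ≡ sumF (λ x → count (P x))
    size-sumF = trans (sym (count-all {size} (λ _ → refl)))
      (trans (count-edge (λ _ → true)) (sumF-cong (λ x → count-cong (λ y → ∧-identityʳ (P x y)))))

    edge-related-at : ∀ {i x y} → edge i ≡ (x , y) → P x y ≡ true
    edge-related-at {i} eq = subst (λ e → uncurry P e ≡ true) eq (edge-related i)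

  -- XY x y: the line {x} × {y} × K carries a marked cell; similarly XZ and YZ. The construction
  -- sees the brick only through these projections and the hypotheses on their counts.
  record BrickShadow : Set where
    field
      n : ℕ
      inI inJ inK : Fin n → Bool
      XY XZ YZ : Fin n → Fin n → Bool
      XY⇒I : ∀ {x y} → XY x y ≡ true → inI x ≡ true
      XY⇒J : ∀ {x y} → XY x y ≡ true → inJ y ≡ true
      XZ⇒I : ∀ {x z} → XZ x z ≡ true → inI x ≡ true
      XZ⇒K : ∀ {x z} → XZ x z ≡ true → inK z ≡ true
      YZ⇒J : ∀ {y z} → YZ y z ≡ true → inJ y ≡ true
      YZ⇒K : ∀ {y z} → YZ y z ≡ true → inK z ≡ true
      possibleˣ : ∀ x → inI x ≡ true → count (XY x) ≡ count (XZ x)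
      possibleʸ : ∀ y → inJ y ≡ true → count (λ x → XY x y) ≡ count (YZ y)
      possibleᶻ : ∀ z → inK z ≡ true → count (λ x → XZ x z) ≡ count (λ y → YZ y z)
      boundˣ : ∀ x → inI x ≡ true → count inJ + count inK ≤ count (XZ x) + n
      boundʸ : ∀ y → inJ y ≡ true → count inI + count inK ≤ count (YZ y) + n
      boundᶻ : ∀ z → inK z ≡ true → count inI + count inJ ≤ count (λ y → YZ y z) + n
      capacity : sumF (count ∘ YZ) + count inJ * n ≤
                 count (not ∘ inK) * count (not ∘ inI) + count inJ * (count inI + count inK)

  module FirstRound (S : BrickShadow) where
    open BrickShadow S

    a b c a' b' c' : ℕ
    a  = count inI
    b  = count inJ
    c  = count inK
    a' = count (not ∘ inI)
    b' = count (not ∘ inJ)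
    c' = count (not ∘ inK)

    a'+a : a' + a ≡ n
    a'+a = count-not inI

    b'+b : b' + b ≡ n
    b'+b = count-not inJ

    c'+c : c' + c ≡ n
    c'+c = count-not inK

    Ī : Fin a' → Fin n
    Ī = enum (not ∘ inI)

    J̄ : Fin b' → Fin n
    J̄ = enum (not ∘ inJ)

    K̄ : Fin c' → Fin n
    K̄ = enum (not ∘ inK)

    Ī-∉ : ∀ γ → inI (Ī γ) ≡ false
    Ī-∉ γ = not≡true⇒≡false (enum-true (not ∘ inI) γ)

    J̄-∉ : ∀ γ → inJ (J̄ γ) ≡ false
    J̄-∉ γ = not≡true⇒≡false (enum-true (not ∘ inJ) γ)

    K̄-∉ : ∀ γ → inK (K̄ γ) ≡ false
    K̄-∉ γ = not≡true⇒≡false (enum-true (not ∘ inK) γ)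

    lacking : Fin n → Fin n → Bool
    lacking y z = inJ y ∧ (inK z ∧ not (YZ y z))

    lacking⇒J : ∀ {y z} → lacking y z ≡ true → inJ y ≡ true
    lacking⇒J {y} h = ∧-conicalˡ (inJ y) _ h

    lacking⇒K : ∀ {y z} → lacking y z ≡ true → inK z ≡ true
    lacking⇒K {y} {z} h = ∧-conicalˡ (inK z) _ (∧-conicalʳ (inJ y) _ h)

    lacking⇒¬YZ : ∀ {y z} → lacking y z ≡ true → YZ y z ≡ false
    lacking⇒¬YZ {y} {z} h = not≡true⇒≡false (∧-conicalʳ (inK z) _ (∧-conicalʳ (inJ y) _ h))

    lacking-count : ∀ y → inJ y ≡ true → count (lacking y) + count (YZ y) ≡ c
    lacking-count y y∈J rewrite y∈J = count-∧-not inK (YZ y) (λ _ → YZ⇒K)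

    YZ-count≤a : ∀ y → inJ y ≡ true → count (YZ y) ≤ a
    YZ-count≤a y y∈J = subst (_≤ a) (possibleʸ y y∈J) (count-mono (λ x → XY x y) inI (λ _ → XY⇒I))

    -- Number of dummy edges added at column y ∈ J so that its degree becomes a'.
    padding : Fin n → ℕ
    padding y = if inJ y then (count (YZ y) + n) ∸ (a + c) else 0

    padding-eq : ∀ y → inJ y ≡ true → padding y + (a + c) ≡ count (YZ y) + n
    padding-eq y y∈J rewrite y∈J = m∸n+n≡m (boundʸ y y∈J)

    padding-∉J : ∀ y → inJ y ≡ false → padding y ≡ 0
    padding-∉J y y∉J rewrite y∉J = refl

    padding≤n : ∀ y → padding y ≤ n
    padding≤n y with bool-cases (inJ y)
    ... | inj₂ y∉J rewrite y∉J = z≤n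
    ... | inj₁ y∈J = +-cancelʳ-≤ (a + c) (padding y) n (begin
      padding y + (a + c)     ≡⟨ padding-eq y y∈J ⟩
      count (YZ y) + n        ≤⟨ +-monoˡ-≤ n (YZ-count≤a y y∈J) ⟩
      a + n                   ≤⟨ +-monoʳ-≤ a (m≤m+n n c) ⟩
      a + (n + c)             ≡⟨ rearrange a n c ⟩
      n + (a + c)             ∎)
      where
      open ≤-Reasoning
      rearrange : ∀ a n c → a + (n + c) ≡ n + (a + c)
      rearrange = solve-∀

    padded : Fin n → Fin n → Bool
    padded y s = inJ y ∧ (toℕ s <ᵇ padding y)

    padded-count : ∀ y → count (padded y) ≡ padding y
    padded-count y with bool-cases (inJ y)
    ... | inj₁ y∈J = trans (count-cong {f = padded y} (λ s → ∧-trueˡ y∈J)) (count-<ᵇ (padding y) (padding≤n y))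
    ... | inj₂ y∉J = trans (count-none {f = padded y} (λ s → ∧-falseˡ y∉J)) (sym (padding-∉J y y∉J))

    module Lacking = RelationEdges lacking
    module Padded  = RelationEdges padded

    M D : ℕ
    M = Lacking.size
    D = Padded.size

    D≤c'*a' : D ≤ c' * a'
    D≤c'*a' = +-cancelʳ-≤ (b * (a + c)) D (c' * a') (begin
      D + b * (a + c)
        ≡⟨ cong₂ _+_ (trans Padded.size-sumF (sumF-cong padded-count)) (sym (sumF-if inJ (a + c))) ⟩
      sumF padding + sumF (λ y → if inJ y then a + c else 0)
        ≡⟨ sumF-+ padding (λ y → if inJ y then a + c else 0) ⟨
      sumF (λ y → padding y + (if inJ y then a + c else 0))
        ≡⟨ sumF-cong balance ⟩
      sumF (λ y → count (YZ y) + (if inJ y then n else 0))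
        ≡⟨ sumF-+ (count ∘ YZ) (λ y → if inJ y then n else 0) ⟩
      sumF (count ∘ YZ) + sumF (λ y → if inJ y then n else 0)
        ≡⟨ cong (λ r → sumF (count ∘ YZ) + r) (sumF-if inJ n) ⟩
      sumF (count ∘ YZ) + b * n
        ≤⟨ capacity ⟩
      c' * a' + b * (a + c) ∎)
      where
      open ≤-Reasoning
      YZ-∉J : ∀ y → inJ y ≡ false → count (YZ y) ≡ 0
      YZ-∉J y y∉J = count-none {f = YZ y} (λ z → ≢true⇒≡false (λ yz → bool-absurd (YZ⇒J yz) y∉J))
      balance : ∀ y → padding y + (if inJ y then a + c else 0) ≡ count (YZ y) + (if inJ y then n else 0)
      balance y with bool-cases (inJ y)
      ... | inj₁ y∈J = trans (cong (λ r → padding y + r) (if-cong y∈J))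
          (trans (padding-eq y y∈J) (cong (λ r → count (YZ y) + r) (sym (if-cong y∈J))))
      ... | inj₂ y∉J = trans (cong₂ _+_ (padding-∉J y y∉J) (if-cong y∉J))
          (sym (cong₂ _+_ (YZ-∉J y y∉J) (if-cong y∉J)))

    dummy-slot : Fin D → Fin c' × Fin a'
    dummy-slot t = remQuot a' (inject≤ t D≤c'*a')

    dummy-slot-injective : ∀ {t t'} → dummy-slot t ≡ dummy-slot t' → t ≡ t'
    dummy-slot-injective {t} {t'} eq = inject≤-injective D≤c'*a' D≤c'*a' t t'
      (trans (sym (combine-remQuot {c'} a' (inject≤ t D≤c'*a')))
        (trans (cong (uncurry combine) eq) (combine-remQuot {c'} a' (inject≤ t' D≤c'*a'))))

    -- The dummy edges leave K; the slots spread them so that no symbol outside K gets more than a'.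
    dummy-edge : Fin D → Fin n × Fin n
    dummy-edge t = proj₁ (Padded.edge t) , K̄ (proj₁ (dummy-slot t))

    G₁ : Fin (M + D) → Fin n × Fin n
    G₁ k = [ Lacking.edge , dummy-edge ]′ (splitAt M k)

    G₁-real : ∀ i → G₁ (i ↑ˡ D) ≡ Lacking.edge i
    G₁-real i rewrite splitAt-↑ˡ M i D = refl

    G₁-dummy : ∀ t → G₁ (M ↑ʳ t) ≡ dummy-edge t
    G₁-dummy t rewrite splitAt-↑ʳ M D t = refl

    degˡ-G₁ : ∀ y → degˡ G₁ y ≡ count (lacking y) + count (padded y)
    degˡ-G₁ y = trans (count-↑ {M} {D} (λ k → proj₁ (G₁ k) ≟ᵇ y))
      (cong₂ _+_ (trans (count-cong (λ i → cong (λ e → proj₁ e ≟ᵇ y) (G₁-real i))) (Lacking.degˡ-edge y))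
                 (trans (count-cong (λ t → cong (λ e → proj₁ e ≟ᵇ y) (G₁-dummy t))) (Padded.degˡ-edge y)))

    degʳ-G₁ : ∀ z → degʳ G₁ z ≡ count (λ y → lacking y z) + count (λ t → K̄ (proj₁ (dummy-slot t)) ≟ᵇ z)
    degʳ-G₁ z = trans (count-↑ {M} {D} (λ k → proj₂ (G₁ k) ≟ᵇ z))
      (cong₂ _+_ (trans (count-cong (λ i → cong (λ e → proj₂ e ≟ᵇ z) (G₁-real i))) (Lacking.degʳ-edge z))
                 (count-cong (λ t → cong (λ e → proj₂ e ≟ᵇ z) (G₁-dummy t))))

    degˡ-G₁-J : ∀ y → inJ y ≡ true → degˡ G₁ y ≡ a'
    degˡ-G₁-J y y∈J = trans (degˡ-G₁ y) (trans (cong (λ r → count (lacking y) + r) (padded-count y))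
      (columns-balance (lacking-count y y∈J) (padding-eq y y∈J) a'+a))
      where
      columns-balance : ∀ {X N r a c a' n} → X + N ≡ c → r + (a + c) ≡ N + n → a' + a ≡ n → X + r ≡ a'
      columns-balance {X} {N} {r} {a} {a' = a'} refl eq refl = +-cancelʳ-≡ (a + N) (X + r) a'
          (trans (shuffle X r a N) (trans eq (shuffle' N a' a)))
        where
        shuffle : ∀ X r a N → (X + r) + (a + N) ≡ r + (a + (X + N))
        shuffle = solve-∀
        shuffle' : ∀ N a' a → N + (a' + a) ≡ a' + (a + N)
        shuffle' = solve-∀

    degˡ-G₁≤ : ∀ y → degˡ G₁ y ≤ a'
    degˡ-G₁≤ y with bool-cases (inJ y)
    ... | inj₁ y∈J = ≤-reflexive (degˡ-G₁-J y y∈J)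
    ... | inj₂ y∉J = subst (_≤ a') (sym (trans (degˡ-G₁ y)
      (cong₂ _+_ (count-none {f = lacking y} (λ z → ∧-falseˡ y∉J))
          (trans (padded-count y) (padding-∉J y y∉J))))) z≤n

    degʳ-G₁≤ : ∀ z → degʳ G₁ z ≤ a'
    degʳ-G₁≤ z with bool-cases (inK z)
    ... | inj₁ z∈K rewrite degʳ-G₁ z
                         | count-none {f = λ t → K̄ (proj₁ (dummy-slot t)) ≟ᵇ z}
                             (λ t → ≢true⇒≡false (λ h → bool-absurd z∈K
                                 (trans (cong inK (sym (≟ᵇ⇒≡ h))) (K̄-∉ _))))
                         | +-identityʳ (count (λ y → lacking y z)) =
      subst (_≤ a') (sym real)
        (difference-bound (count-∧-not inJ (λ y → YZ y z) (λ _ → YZ⇒J)) (boundᶻ z z∈K) a'+a)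
      where
      real : count (λ y → lacking y z) ≡ count (λ y → inJ y ∧ not (YZ y z))
      real = count-cong (λ y → cong (inJ y ∧_) (∧-trueˡ z∈K))
    ... | inj₂ z∉K rewrite degʳ-G₁ z
                         | count-none {f = λ y → lacking y z}
                             (λ y → trans (cong (inJ y ∧_) (∧-falseˡ z∉K)) (∧-zeroʳ (inJ y))) =
      count≤-injection _ (λ t _ → proj₂ (dummy-slot t))
        (λ h h' eq → dummy-slot-injective (cong₂ _,_
            (enum-injective (not ∘ inK) (trans (≟ᵇ⇒≡ h) (sym (≟ᵇ⇒≡ h')))) eq))

    abstract
      col₁ : Fin (M + D) → Fin a'
      col₁ = proj₁ (konig a' (M + D) G₁ degˡ-G₁≤ degʳ-G₁≤)

      col₁-proper : ProperColouring G₁ col₁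
      col₁-proper = proj₂ (konig a' (M + D) G₁ degˡ-G₁≤ degʳ-G₁≤)

    row₁ : Fin M → Fin n
    row₁ i = Ī (col₁ (i ↑ˡ D))

    row₁-∉I : ∀ i → inI (row₁ i) ≡ false
    row₁-∉I i = Ī-∉ _

    row₁-unique : ∀ {i i'} → Adjacent Lacking.edge i i' → row₁ i ≡ row₁ i' → i ≡ i'
    row₁-unique {i} {i'} adj same = ↑ˡ-injective D i i'
      (proper-unique G₁ col₁-proper (Adjacent-transport G₁ Lacking.edge (G₁-real i) (G₁-real i') adj)
        (enum-injective (not ∘ inI) same))

    row₁-count : ∀ x → inI x ≡ false → b ≤ count (λ i → row₁ i ≟ᵇ x) + c'
    row₁-count x x∉I = begin
      b
        ≤⟨ every-column ⟩
      count (λ k → col₁ k ≟ᵇ γ)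
        ≡⟨ count-↑ {M} {D} (λ k → col₁ k ≟ᵇ γ) ⟩
      count (λ i → col₁ (i ↑ˡ D) ≟ᵇ γ) + count (λ t → col₁ (M ↑ʳ t) ≟ᵇ γ)
        ≤⟨ +-monoʳ-≤ _ few-dummies ⟩
      count (λ i → col₁ (i ↑ˡ D) ≟ᵇ γ) + c'
        ≡⟨ cong (_+ c') (count-cong as-rows) ⟩
      count (λ i → row₁ i ≟ᵇ x) + c' ∎
      where
      open ≤-Reasoning
      γ : Fin a'
      γ = rank (not ∘ inI) x (cong not x∉I)
      Īγ : Ī γ ≡ x
      Īγ = enum-rank (not ∘ inI) x (cong not x∉I)
      present : ∀ y → inJ y ≡ true → ∃ λ k → proj₁ (G₁ k) ≡ y × col₁ k ≡ γ
      present y y∈J = colour-at-full-left G₁ col₁-proper y (degˡ-G₁-J y y∈J) γ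
      every-column : b ≤ count (λ k → col₁ k ≟ᵇ γ)
      every-column = count-mono-injection inJ _ (λ y y∈J → proj₁ (present y y∈J))
        (λ y y∈J → ≡⇒≟ᵇ (proj₂ (proj₂ (present y y∈J))))
        (λ y∈J y'∈J eq → trans (sym (proj₁ (proj₂ (present _ y∈J))))
          (trans (cong (proj₁ ∘ G₁) eq) (proj₁ (proj₂ (present _ y'∈J)))))
      few-dummies : count (λ t → col₁ (M ↑ʳ t) ≟ᵇ γ) ≤ c'
      few-dummies = count≤-injection _ (λ t _ → proj₁ (dummy-slot t))
        (λ {t} {t'} h h' eq → ↑ʳ-injective M t t' (proper-unique G₁ col₁-proper
          (Adjacent-transport G₁ dummy-edge (G₁-dummy t) (G₁-dummy t') (inj₂ (cong K̄ eq)))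
          (trans (≟ᵇ⇒≡ h) (sym (≟ᵇ⇒≡ h')))))
      as-rows : ∀ i → (col₁ (i ↑ˡ D) ≟ᵇ γ) ≡ (row₁ i ≟ᵇ x)
      as-rows i = trans (sym (≟ᵇ-injective Ī (enum-injective (not ∘ inI)) _ γ)) (cong (row₁ i ≟ᵇ_) Īγ)

  module SecondRound (S : BrickShadow) where
    open BrickShadow S
    open FirstRound S

    placed₁? : ∀ x z → Dec (∃ λ i → proj₂ (Lacking.edge i) ≡ z × row₁ i ≡ x)
    placed₁? x z = any? (λ i → (proj₂ (Lacking.edge i) ≟ z) ×-dec (row₁ i ≟ x))

    placed₁ : Fin n → Fin n → Bool
    placed₁ x z = does (placed₁? x z)

    placed₁-witness : ∀ {x z} → placed₁ x z ≡ true → ∃ λ i → proj₂ (Lacking.edge i) ≡ z × row₁ i ≡ x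
    placed₁-witness {x} {z} = dec-witness (placed₁? x z)

    placed₁⇒∉I : ∀ {x z} → placed₁ x z ≡ true → inI x ≡ false
    placed₁⇒∉I h with placed₁-witness h
    ... | i , _ , row≡x = subst (λ x → inI x ≡ false) row≡x (row₁-∉I i)

    placed₁⇒K : ∀ {x z} → placed₁ x z ≡ true → inK z ≡ true
    placed₁⇒K h with placed₁-witness h
    ... | i , at-z , _ = subst (λ z → inK z ≡ true) at-z (lacking⇒K (Lacking.edge-related i))

    ∉I⇒¬XZ : ∀ {x z} → inI x ≡ false → XZ x z ≡ false
    ∉I⇒¬XZ x∉I = ≢true⇒≡false (λ xz → bool-absurd (XZ⇒I xz) x∉I)

    placed₁-count-symbol : ∀ z → count (λ x → placed₁ x z) ≡ count (λ y → lacking y z)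
    placed₁-count-symbol z = trans (≤-antisym to from) (Lacking.degʳ-edge z)
      where
      to : count (λ x → placed₁ x z) ≤ degʳ Lacking.edge z
      to = count-mono-injection _ _ (λ x h → proj₁ (placed₁-witness h))
        (λ x h → ≡⇒≟ᵇ (proj₁ (proj₂ (placed₁-witness h))))
        (λ h h' eq → trans (sym (proj₂ (proj₂ (placed₁-witness h))))
          (trans (cong row₁ eq) (proj₂ (proj₂ (placed₁-witness h')))))
      from : degʳ Lacking.edge z ≤ count (λ x → placed₁ x z)
      from = count-mono-injection _ _ (λ i _ → row₁ i)
        (λ i h → dec-true (placed₁? (row₁ i) z) (i , ≟ᵇ⇒≡ h , refl))
        (λ h h' eq → row₁-unique (inj₂ (trans (≟ᵇ⇒≡ h) (sym (≟ᵇ⇒≡ h')))) eq)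

    placed₁-count-row : ∀ x → count (placed₁ x) ≡ count (λ i → row₁ i ≟ᵇ x)
    placed₁-count-row x = ≤-antisym to from
      where
      to : count (placed₁ x) ≤ count (λ i → row₁ i ≟ᵇ x)
      to = count-mono-injection _ _ (λ z h → proj₁ (placed₁-witness h))
        (λ z h → ≡⇒≟ᵇ (proj₂ (proj₂ (placed₁-witness h))))
        (λ h h' eq → trans (sym (proj₁ (proj₂ (placed₁-witness h))))
          (trans (cong (proj₂ ∘ Lacking.edge) eq) (proj₁ (proj₂ (placed₁-witness h')))))
      from : count (λ i → row₁ i ≟ᵇ x) ≤ count (placed₁ x)
      from = count-mono-injection _ _ (λ i _ → proj₂ (Lacking.edge i))
        (λ i h → dec-true (placed₁? x _) (i , refl , ≟ᵇ⇒≡ h))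
        (λ h h' eq → row₁-unique (inj₂ eq) (trans (≟ᵇ⇒≡ h) (sym (≟ᵇ⇒≡ h'))))

    rowLacking : Fin n → Fin n → Bool
    rowLacking x z = inK z ∧ (not (XZ x z) ∧ not (placed₁ x z))

    rowLacking⇒K : ∀ {x z} → rowLacking x z ≡ true → inK z ≡ true
    rowLacking⇒K {x} {z} h = ∧-conicalˡ (inK z) _ h

    rowLacking⇒¬XZ : ∀ {x z} → rowLacking x z ≡ true → XZ x z ≡ false
    rowLacking⇒¬XZ {x} {z} h = not≡true⇒≡false (∧-conicalˡ (not (XZ x z)) _ (∧-conicalʳ (inK z) _ h))

    rowLacking⇒¬placed₁ : ∀ {x z} → rowLacking x z ≡ true → placed₁ x z ≡ false
    rowLacking⇒¬placed₁ {x} {z} h = not≡true⇒≡false (∧-conicalʳ (not (XZ x z)) _ (∧-conicalʳ (inK z) _ h))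

    module RowLacking = RelationEdges rowLacking

    G₂ : Fin RowLacking.size → Fin n × Fin n
    G₂ = RowLacking.edge

    rowLacking-count-∈I : ∀ x → inI x ≡ true → count (rowLacking x) + count (XZ x) ≡ c
    rowLacking-count-∈I x x∈I = trans (cong (_+ count (XZ x)) (count-cong simplify))
        (count-∧-not inK (XZ x) (λ _ → XZ⇒K))
      where
      simplify : ∀ z → rowLacking x z ≡ inK z ∧ not (XZ x z)
      simplify z with bool-cases (placed₁ x z)
      ... | inj₁ placed = bool-absurd x∈I (placed₁⇒∉I placed)
      ... | inj₂ ¬placed rewrite ¬placed = cong (inK z ∧_) (∧-identityʳ (not (XZ x z)))

    rowLacking-count-∉I : ∀ x → inI x ≡ false → count (rowLacking x) + count (placed₁ x) ≡ c
    rowLacking-count-∉I x x∉I = trans (cong (_+ count (placed₁ x)) (count-cong simplify))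
        (count-∧-not inK (placed₁ x) (λ _ → placed₁⇒K))
      where
      simplify : ∀ z → rowLacking x z ≡ inK z ∧ not (placed₁ x z)
      simplify z rewrite ∉I⇒¬XZ {z = z} x∉I = refl

    degˡ-G₂≤ : ∀ x → degˡ G₂ x ≤ b'
    degˡ-G₂≤ x with bool-cases (inI x)
    ... | inj₁ x∈I = subst (_≤ b') (sym (RowLacking.degˡ-edge x))
      (difference-bound (rowLacking-count-∈I x x∈I) (boundˣ x x∈I) b'+b)
    ... | inj₂ x∉I = subst (_≤ b') (sym (RowLacking.degˡ-edge x))
      (rows-balance (rowLacking-count-∉I x x∉I) (≤-reflexive (sym (placed₁-count-row x)))
          (row₁-count x x∉I) c'+c b'+b)
      where
      rows-balance : ∀ {X U c R b c' b' n} → X + U ≡ c → R ≤ U → b ≤ R + c' → c' + c ≡ n → b' + b ≡ n → X ≤ b'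
      rows-balance {X} {U} {R = R} {b} {c'} {b'} refl R≤U b≤ refl b'+b≡ = +-cancelʳ-≤ b X b' (begin
        X + b           ≤⟨ +-monoʳ-≤ X b≤ ⟩
        X + (R + c')    ≤⟨ +-monoʳ-≤ X (+-monoˡ-≤ c' R≤U) ⟩
        X + (U + c')    ≡⟨ shuffle X U c' ⟩
        c' + (X + U)    ≡⟨ b'+b≡ ⟨
        b' + b          ∎)
        where
        open ≤-Reasoning
        shuffle : ∀ X U c' → X + (U + c') ≡ c' + (X + U)
        shuffle = solve-∀

    degʳ-G₂-K : ∀ z → inK z ≡ true → degʳ G₂ z ≡ b'
    degʳ-G₂-K z z∈K = trans (RowLacking.degʳ-edge z) (symbols-balance free-split all-rows in-J b'+b)
      where
      free-split : count (λ x → rowLacking x z) + count (λ x → placed₁ x z) ≡ count (λ x → not (XZ x z))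
      free-split = trans (cong (_+ count (λ x → placed₁ x z))
          (count-cong {f = λ x → rowLacking x z} (λ x → ∧-trueˡ z∈K)))
        (count-∧-not (λ x → not (XZ x z)) (λ x → placed₁ x z) (λ x h → cong not (∉I⇒¬XZ (placed₁⇒∉I h))))
      all-rows : count (λ x → not (XZ x z)) + count (λ y → YZ y z) ≡ n
      all-rows = trans (cong (λ r → count (λ x → not (XZ x z)) + r) (sym (possibleᶻ z z∈K)))
          (count-not (λ x → XZ x z))
      in-J : count (λ x → placed₁ x z) + count (λ y → YZ y z) ≡ b
      in-J = trans (cong (_+ count (λ y → YZ y z)) (trans (placed₁-count-symbol z)
          (count-cong {f = λ y → lacking y z} (λ y → cong (inJ y ∧_) (∧-trueˡ z∈K)))))
        (count-∧-not inJ (λ y → YZ y z) (λ _ → YZ⇒J))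
      symbols-balance : ∀ {X U F N n b b'} → X + U ≡ F → F + N ≡ n → U + N ≡ b → b' + b ≡ n → X ≡ b'
      symbols-balance {X} {U} {N = N} {b' = b'} refl refl refl eq = +-cancelʳ-≡ (U + N) X b'
          (trans (sym (+-assoc X U N)) (sym eq))

    degʳ-G₂≤ : ∀ z → degʳ G₂ z ≤ b'
    degʳ-G₂≤ z with bool-cases (inK z)
    ... | inj₁ z∈K = ≤-reflexive (degʳ-G₂-K z z∈K)
    ... | inj₂ z∉K = subst (_≤ b') (sym (trans (RowLacking.degʳ-edge z)
        (count-none {f = λ x → rowLacking x z} (λ x → ∧-falseˡ z∉K)))) z≤n

    abstract
      col₂ : Fin RowLacking.size → Fin b'
      col₂ = proj₁ (konig b' RowLacking.size G₂ degˡ-G₂≤ degʳ-G₂≤)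

      col₂-proper : ProperColouring G₂ col₂
      col₂-proper = proj₂ (konig b' RowLacking.size G₂ degˡ-G₂≤ degʳ-G₂≤)

    column₂ : Fin RowLacking.size → Fin n
    column₂ k = J̄ (col₂ k)

    column₂-∉J : ∀ k → inJ (column₂ k) ≡ false
    column₂-∉J k = J̄-∉ _

    column₂-unique : ∀ {k k'} → Adjacent G₂ k k' → column₂ k ≡ column₂ k' → k ≡ k'
    column₂-unique adj same = proper-unique G₂ col₂-proper adj (enum-injective (not ∘ inJ) same)

    column₂-covers : ∀ y → inJ y ≡ false → ∀ z → inK z ≡ true → ∃ λ k → proj₂ (G₂ k) ≡ z × column₂ k ≡ y
    column₂-covers y y∉J z z∈K with colour-at-full-right G₂ col₂-proper z (degʳ-G₂-K z z∈K)
        (rank (not ∘ inJ) y (cong not y∉J))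
    ... | k , at-z , colk = k , at-z , trans (cong J̄ colk) (enum-rank (not ∘ inJ) y (cong not y∉J))

  module ThirdRound (S : BrickShadow) where
    open BrickShadow S
    open FirstRound S
    open SecondRound S

    filled₁? : ∀ x y → Dec (∃ λ i → proj₁ (Lacking.edge i) ≡ y × row₁ i ≡ x)
    filled₁? x y = any? (λ i → (proj₁ (Lacking.edge i) ≟ y) ×-dec (row₁ i ≟ x))

    filled₂? : ∀ x y → Dec (∃ λ k → proj₁ (G₂ k) ≡ x × column₂ k ≡ y)
    filled₂? x y = any? (λ k → (proj₁ (G₂ k) ≟ x) ×-dec (column₂ k ≟ y))

    filled₁ filled₂ occupied : Fin n → Fin n → Bool
    filled₁ x y = does (filled₁? x y)
    filled₂ x y = does (filled₂? x y)
    occupied x y = XY x y ∨ (filled₁ x y ∨ filled₂ x y)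

    filled₁⇒∉I : ∀ {x y} → filled₁ x y ≡ true → inI x ≡ false
    filled₁⇒∉I {x} {y} h with dec-witness (filled₁? x y) h
    ... | i , _ , row≡x = subst (λ x → inI x ≡ false) row≡x (row₁-∉I i)

    filled₁⇒J : ∀ {x y} → filled₁ x y ≡ true → inJ y ≡ true
    filled₁⇒J {x} {y} h with dec-witness (filled₁? x y) h
    ... | i , at-y , _ = subst (λ y → inJ y ≡ true) at-y (lacking⇒J (Lacking.edge-related i))

    filled₂⇒∉J : ∀ {x y} → filled₂ x y ≡ true → inJ y ≡ false
    filled₂⇒∉J {x} {y} h with dec-witness (filled₂? x y) h
    ... | k , _ , column≡y = subst (λ y → inJ y ≡ false) column≡y (column₂-∉J k)

    filled-disjoint : ∀ {x y} → filled₁ x y ≡ true → filled₂ x y ≡ false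
    filled-disjoint h = ≢true⇒≡false (λ h' → bool-absurd (filled₁⇒J h) (filled₂⇒∉J h'))

    XY-disjoint : ∀ {x y} → XY x y ≡ true → filled₁ x y ∨ filled₂ x y ≡ false
    XY-disjoint {x} {y} xy = trans (cong (_∨ filled₂ x y)
        (≢true⇒≡false (λ h → bool-absurd (XY⇒I xy) (filled₁⇒∉I h))))
                                   (≢true⇒≡false (λ h → bool-absurd (XY⇒J xy) (filled₂⇒∉J h)))

    occupied-count-row : ∀ x → count (occupied x) ≡ count (XY x) + (count (filled₁ x) + count (filled₂ x))
    occupied-count-row x = trans (count-∨-disjoint (XY x) _ (λ _ → XY-disjoint))
      (cong (λ r → count (XY x) + r) (count-∨-disjoint (filled₁ x) (filled₂ x) (λ _ → filled-disjoint)))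

    occupied-count-column : ∀ y → count (λ x → occupied x y) ≡
      count (λ x → XY x y) + (count (λ x → filled₁ x y) + count (λ x → filled₂ x y))
    occupied-count-column y = trans (count-∨-disjoint (λ x → XY x y) _ (λ _ → XY-disjoint))
      (cong (λ r → count (λ x → XY x y) + r) (count-∨-disjoint (λ x → filled₁ x y)
          (λ x → filled₂ x y) (λ _ → filled-disjoint)))

    filled₁-row : ∀ x → count (λ i → row₁ i ≟ᵇ x) ≤ count (filled₁ x)
    filled₁-row x = count-mono-injection _ (filled₁ x) (λ i _ → proj₁ (Lacking.edge i))
      (λ i h → dec-true (filled₁? x _) (i , refl , ≟ᵇ⇒≡ h))
      (λ h h' same → row₁-unique (inj₁ same) (trans (≟ᵇ⇒≡ h) (sym (≟ᵇ⇒≡ h'))))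

    filled₁-column : ∀ y → count (lacking y) ≤ count (λ x → filled₁ x y)
    filled₁-column y = count-mono-injection (lacking y) (λ x → filled₁ x y)
      (λ z h → row₁ (Lacking.index y z h))
      (λ z h → dec-true (filled₁? _ y) (Lacking.index y z h , cong proj₁ (Lacking.edge-index y z h) , refl))
      (λ h h' same → Lacking.index-injective h h' (row₁-unique (Lacking.index-adjacent h h') same))

    filled₂-row : ∀ x → count (rowLacking x) ≤ count (filled₂ x)
    filled₂-row x = count-mono-injection (rowLacking x) (filled₂ x)
      (λ z h → column₂ (RowLacking.index x z h))
      (λ z h → dec-true (filled₂? x _) (RowLacking.index x z h , cong proj₁ (RowLacking.edge-index x z h) , refl))
      (λ h h' same → RowLacking.index-injective h h' (column₂-unique (RowLacking.index-adjacent h h') same))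

    filled₂-column : ∀ y → inJ y ≡ false → c ≤ count (λ x → filled₂ x y)
    filled₂-column y y∉J = count-mono-injection inK (λ x → filled₂ x y)
        (λ z z∈K → proj₁ (G₂ (proj₁ (covers z z∈K))))
      (λ z z∈K → dec-true (filled₂? _ y) (proj₁ (covers z z∈K) , refl , proj₂ (proj₂ (covers z z∈K))))
      (λ z∈K z'∈K same → trans (sym (proj₁ (proj₂ (covers _ z∈K))))
        (trans (cong (proj₂ ∘ G₂) (column₂-unique (inj₁ same)
                 (trans (proj₂ (proj₂ (covers _ z∈K))) (sym (proj₂ (proj₂ (covers _ z'∈K)))))))
               (proj₁ (proj₂ (covers _ z'∈K)))))
      where
      covers = column₂-covers y y∉J

    occupied-row-≥ : ∀ x → c ≤ count (occupied x)
    occupied-row-≥ x with bool-cases (inI x)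
    ... | inj₁ x∈I = begin
      c
        ≡⟨ rowLacking-count-∈I x x∈I ⟨
      count (rowLacking x) + count (XZ x)
        ≡⟨ +-comm (count (rowLacking x)) _ ⟩
      count (XZ x) + count (rowLacking x)
        ≡⟨ cong (_+ count (rowLacking x)) (possibleˣ x x∈I) ⟨
      count (XY x) + count (rowLacking x)
        ≤⟨ +-monoʳ-≤ (count (XY x)) (≤-trans (filled₂-row x) (m≤n+m _ _)) ⟩
      count (XY x) + (count (filled₁ x) + count (filled₂ x))
        ≡⟨ occupied-count-row x ⟨
      count (occupied x) ∎
      where open ≤-Reasoning
    ... | inj₂ x∉I = begin
      c
        ≡⟨ rowLacking-count-∉I x x∉I ⟨
      count (rowLacking x) + count (placed₁ x)
        ≡⟨ +-comm (count (rowLacking x)) _ ⟩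
      count (placed₁ x) + count (rowLacking x)
        ≤⟨ +-mono-≤ (≤-trans (≤-reflexive (placed₁-count-row x)) (filled₁-row x)) (filled₂-row x) ⟩
      count (filled₁ x) + count (filled₂ x)
        ≤⟨ m≤n+m _ (count (XY x)) ⟩
      count (XY x) + (count (filled₁ x) + count (filled₂ x))
        ≡⟨ occupied-count-row x ⟨
      count (occupied x) ∎
      where open ≤-Reasoning

    occupied-column-≥ : ∀ y → c ≤ count (λ x → occupied x y)
    occupied-column-≥ y with bool-cases (inJ y)
    ... | inj₁ y∈J = begin
      c
        ≡⟨ lacking-count y y∈J ⟨
      count (lacking y) + count (YZ y)
        ≡⟨ +-comm (count (lacking y)) _ ⟩
      count (YZ y) + count (lacking y)
        ≡⟨ cong (_+ count (lacking y)) (possibleʸ y y∈J) ⟨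
      count (λ x → XY x y) + count (lacking y)
        ≤⟨ +-monoʳ-≤ (count (λ x → XY x y)) (≤-trans (filled₁-column y) (m≤m+n _ _)) ⟩
      count (λ x → XY x y) + (count (λ x → filled₁ x y) + count (λ x → filled₂ x y))
        ≡⟨ occupied-count-column y ⟨
      count (λ x → occupied x y) ∎
      where open ≤-Reasoning
    ... | inj₂ y∉J = begin
      c
        ≤⟨ filled₂-column y y∉J ⟩
      count (λ x → filled₂ x y)
        ≤⟨ m≤n+m _ _ ⟩
      count (λ x → filled₁ x y) + count (λ x → filled₂ x y)
        ≤⟨ m≤n+m _ (count (λ x → XY x y)) ⟩
      count (λ x → XY x y) + (count (λ x → filled₁ x y) + count (λ x → filled₂ x y))
        ≡⟨ occupied-count-column y ⟨
      count (λ x → occupied x y) ∎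
      where open ≤-Reasoning

    vacant : Fin n → Fin n → Bool
    vacant x y = not (occupied x y)

    module Vacant = RelationEdges vacant

    G₃ : Fin Vacant.size → Fin n × Fin n
    G₃ = Vacant.edge

    vacant-bound : ∀ {N U} → N + U ≡ n → c ≤ U → N ≤ c'
    vacant-bound {N} {U} N+U≡n c≤U = +-cancelʳ-≤ c N c' (begin
      N + c     ≤⟨ +-monoʳ-≤ N c≤U ⟩
      N + U     ≡⟨ N+U≡n ⟩
      n         ≡⟨ c'+c ⟨
      c' + c    ∎)
      where open ≤-Reasoning

    degˡ-G₃≤ : ∀ x → degˡ G₃ x ≤ c'
    degˡ-G₃≤ x = subst (_≤ c') (sym (Vacant.degˡ-edge x))
      (vacant-bound (count-not (occupied x)) (occupied-row-≥ x))

    degʳ-G₃≤ : ∀ y → degʳ G₃ y ≤ c'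
    degʳ-G₃≤ y = subst (_≤ c') (sym (Vacant.degʳ-edge y))
      (vacant-bound (count-not (λ x → occupied x y)) (occupied-column-≥ y))

    abstract
      col₃ : Fin Vacant.size → Fin c'
      col₃ = proj₁ (konig c' Vacant.size G₃ degˡ-G₃≤ degʳ-G₃≤)

      col₃-proper : ProperColouring G₃ col₃
      col₃-proper = proj₂ (konig c' Vacant.size G₃ degˡ-G₃≤ degʳ-G₃≤)

    symbol₃ : Fin Vacant.size → Fin n
    symbol₃ j = K̄ (col₃ j)

    symbol₃-unique : ∀ {j j'} → Adjacent G₃ j j' → symbol₃ j ≡ symbol₃ j' → j ≡ j'
    symbol₃-unique adj same = proper-unique G₃ col₃-proper adj (enum-injective (not ∘ inK) same)

  module Filling (S : BrickShadow) where
    open BrickShadow S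
    open FirstRound S
    open SecondRound S
    open ThirdRound S

    -- The last clause is a junk value: it is only reached on the cells of XY.
    symbolAt : ∀ x y → Dec (∃ λ i → proj₁ (Lacking.edge i) ≡ y × row₁ i ≡ x) →
      Dec (∃ λ k → proj₁ (G₂ k) ≡ x × column₂ k ≡ y) → Dec (vacant x y ≡ true) → Fin n
    symbolAt x y (yes (i , _)) _            _       = proj₂ (Lacking.edge i)
    symbolAt x y (no _)       (yes (k , _)) _       = proj₂ (G₂ k)
    symbolAt x y (no _)       (no _)       (yes h) = symbol₃ (Vacant.index x y h)
    symbolAt x y (no _)       (no _)       (no _)  = x

    L : Fin n → Fin n → Fin n
    L x y = symbolAt x y (filled₁? x y) (filled₂? x y) (vacant x y Bool.≟ true)

    data Source (x y z : Fin n) : Set where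
      first  : ∀ i → Lacking.edge i ≡ (y , z) → row₁ i ≡ x → Source x y z
      second : ∀ k → G₂ k ≡ (x , z) → column₂ k ≡ y → Source x y z
      third  : ∀ j → G₃ j ≡ (x , y) → symbol₃ j ≡ z → Source x y z

    source : ∀ x y → XY x y ≡ false → Source x y (L x y)
    source x y ¬xy = go (filled₁? x y) (filled₂? x y) (vacant x y Bool.≟ true)
      where
      go : ∀ d₁ d₂ d₃ → Source x y (symbolAt x y d₁ d₂ d₃)
      go (yes (i , at-y , row≡x)) _ _ = first i (cong (_, _) at-y) row≡x
      go (no _) (yes (k , at-x , column≡y)) _ = second k (cong (_, _) at-x) column≡y
      go (no _) (no _) (yes h) = third (Vacant.index x y h) (Vacant.edge-index x y h) refl
      go (no ¬f₁) (no ¬f₂) (no ¬vacant) = ⊥-elim (¬vacant vacant-xy)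
        where
        vacant-xy : vacant x y ≡ true
        vacant-xy rewrite ¬xy | dec-false (filled₁? x y) ¬f₁ | dec-false (filled₂? x y) ¬f₂ = refl

    first⇒K : ∀ {i y z} → Lacking.edge i ≡ (y , z) → inK z ≡ true
    first⇒K e = lacking⇒K (Lacking.edge-related-at e)

    second⇒K : ∀ {k x z} → G₂ k ≡ (x , z) → inK z ≡ true
    second⇒K e = rowLacking⇒K (RowLacking.edge-related-at e)

    first⇒J : ∀ {i y z} → Lacking.edge i ≡ (y , z) → inJ y ≡ true
    first⇒J e = lacking⇒J (Lacking.edge-related-at e)

    second⇒∉J : ∀ {k y} → column₂ k ≡ y → inJ y ≡ false
    second⇒∉J {k} refl = column₂-∉J k

    first⇒placed₁ : ∀ {i x y z} → Lacking.edge i ≡ (y , z) → row₁ i ≡ x → placed₁ x z ≡ true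
    first⇒placed₁ {i} {x} {z = z} e r = dec-true (placed₁? x z) (i , cong proj₂ e , r)

    third⇒∉K : ∀ {j z} → symbol₃ j ≡ z → inK z ≡ false
    third⇒∉K {j} refl = K̄-∉ (col₃ j)

    L-row-injective : ∀ {x y y'} → XY x y ≡ false → XY x y' ≡ false → L x y ≡ L x y' → y ≡ y'
    L-row-injective {x} {y} {y'} ¬xy ¬xy' same with source x y ¬xy | source x y' ¬xy'
    ... | first i e r | first i' e' r' = cong proj₁ (trans (sym e)
          (trans (cong Lacking.edge (row₁-unique
              (inj₂ (trans (cong proj₂ e) (trans same (sym (cong proj₂ e'))))) (trans r (sym r')))) e'))
    ... | second k e c | second k' e' c' = trans (sym c)
          (trans (cong column₂ (RowLacking.edge-injective (trans e (trans (cong (x ,_) same) (sym e'))))) c')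
    ... | third j e s | third j' e' s' = cong proj₂ (trans (sym e)
          (trans (cong G₃ (symbol₃-unique (inj₁ (trans (cong proj₁ e) (sym (cong proj₁ e'))))
              (trans s (trans same (sym s'))))) e'))
    ... | first i e r | second k' e' c' =
          bool-absurd (subst (λ z → placed₁ x z ≡ true) same (first⇒placed₁ e r))
              (rowLacking⇒¬placed₁ (RowLacking.edge-related-at e'))
    ... | second k e c | first i' e' r' =
          bool-absurd (subst (λ z → placed₁ x z ≡ true) (sym same) (first⇒placed₁ e' r'))
              (rowLacking⇒¬placed₁ (RowLacking.edge-related-at e))
    ... | first i e r | third j' e' s' = bool-absurd (first⇒K e) (third⇒∉K (trans s' (sym same)))
    ... | second k e c | third j' e' s' = bool-absurd (second⇒K e) (third⇒∉K (trans s' (sym same)))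
    ... | third j e s | first i' e' r' = bool-absurd (first⇒K e') (third⇒∉K (trans s same))
    ... | third j e s | second k' e' c' = bool-absurd (second⇒K e') (third⇒∉K (trans s same))

    L-column-injective : ∀ {x x' y} → XY x y ≡ false → XY x' y ≡ false → L x y ≡ L x' y → x ≡ x'
    L-column-injective {x} {x'} {y} ¬xy ¬x'y same with source x y ¬xy | source x' y ¬x'y
    ... | first i e r | first i' e' r' =
          trans (sym r) (trans (cong row₁ (Lacking.edge-injective
              (trans e (trans (cong (y ,_) same) (sym e'))))) r')
    ... | second k e c | second k' e' c' = cong proj₁ (trans (sym e)
          (trans (cong G₂ (column₂-unique (inj₂
              (trans (cong proj₂ e) (trans same (sym (cong proj₂ e'))))) (trans c (sym c')))) e'))
    ... | third j e s | third j' e' s' = cong proj₁ (trans (sym e)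
          (trans (cong G₃ (symbol₃-unique (inj₂ (trans (cong proj₂ e) (sym (cong proj₂ e'))))
              (trans s (trans same (sym s'))))) e'))
    ... | first i e r | second k' e' c' = bool-absurd (first⇒J e) (second⇒∉J c')
    ... | second k e c | first i' e' r' = bool-absurd (first⇒J e') (second⇒∉J c)
    ... | first i e r | third j' e' s' = bool-absurd (first⇒K e) (third⇒∉K (trans s' (sym same)))
    ... | second k e c | third j' e' s' = bool-absurd (second⇒K e) (third⇒∉K (trans s' (sym same)))
    ... | third j e s | first i' e' r' = bool-absurd (first⇒K e') (third⇒∉K (trans s same))
    ... | third j e s | second k' e' c' = bool-absurd (second⇒K e') (third⇒∉K (trans s same))

    L-∉XZ : ∀ {x y} → XY x y ≡ false → XZ x (L x y) ≡ false
    L-∉XZ {x} {y} ¬xy with source x y ¬xy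
    ... | first i e r = ∉I⇒¬XZ (subst (λ x → inI x ≡ false) r (row₁-∉I i))
    ... | second k e c = rowLacking⇒¬XZ (RowLacking.edge-related-at e)
    ... | third j e s = ≢true⇒≡false (λ xz → bool-absurd (XZ⇒K xz) (third⇒∉K s))

    L-∉YZ : ∀ {x y} → XY x y ≡ false → YZ y (L x y) ≡ false
    L-∉YZ {x} {y} ¬xy with source x y ¬xy
    ... | first i e r = lacking⇒¬YZ (Lacking.edge-related-at e)
    ... | second k e c = ≢true⇒≡false (λ yz → bool-absurd (YZ⇒J yz) (second⇒∉J c))
    ... | third j e s = ≢true⇒≡false (λ yz → bool-absurd (YZ⇒K yz) (third⇒∉K s))

    L-∉K : ∀ {x y} → XY x y ≡ false → inI x ≡ true → inJ y ≡ true → inK (L x y) ≡ false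
    L-∉K {x} {y} ¬xy x∈I y∈J with source x y ¬xy
    ... | first i e r = bool-absurd x∈I (subst (λ x → inI x ≡ false) r (row₁-∉I i))
    ... | second k e c = bool-absurd y∈J (second⇒∉J c)
    ... | third j e s = third⇒∉K s

  anyF-intro : ∀ {N} (f : Fin N → Bool) k → f k ≡ true → anyF f ≡ true
  anyF-intro f zero    fk rewrite fk = refl
  anyF-intro f (suc k) fk rewrite anyF-intro (f ∘ suc) k fk = ∨-zeroʳ (f zero)

  ∣∣≡count : ∀ {N} (S : Subset N) → ∣ S ∣ ≡ count (mem S)
  ∣∣≡count []          = refl
  ∣∣≡count (true ∷ S)  = cong suc (∣∣≡count S)
  ∣∣≡count (false ∷ S) = ∣∣≡count S

  isMarked-≢blank : ∀ m → m ≢ blank → isMarked m ≡ true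
  isMarked-≢blank blank m≢blank = ⊥-elim (m≢blank refl)
  isMarked-≢blank rook  _       = refl
  isMarked-≢blank dot   _       = refl

  +[m+n]-+n≡+m : ∀ m n → + (m + n) ℤ.- + n ≡ + m
  +[m+n]-+n≡+m m n = trans (cong (ℤ._- + n) (ℤP.pos-+ m n)) (cancel (+ m) (+ n))
    where
    cancel : ∀ (x y : ℤ) → x ℤ.+ y ℤ.- y ≡ x
    cancel = ℤ-Solver.solve-∀

  bound-in-ℕ : ∀ {N x n} → + N ℤ.≥ + x ℤ.- + n → x ≤ N + n
  bound-in-ℕ {N} {x} {n} hyp = ℤP.drop‿+≤+ (subst (ℤ._≤ + (N + n)) (cancel (+ x) (+ n))
      (ℤP.+-monoˡ-≤ (+ n) hyp))
    where
    cancel : ∀ (x y : ℤ) → x ℤ.- y ℤ.+ y ≡ x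
    cancel = ℤ-Solver.solve-∀

  capacity-in-ℕ : ∀ {p a b c a' c' n} → a' + a ≡ n → c' + c ≡ n →
    + p ℤ.≤ + a ℤ.* + b ℤ.- (+ n ℤ.- + c) ℤ.* (+ a ℤ.+ + b ℤ.- + n) →
    p + b * n ≤ c' * a' + b * (a + c)
  capacity-in-ℕ {p} {a} {b} {c} {a'} {c'} {n} refl c'+c≡n hyp = ℤP.drop‿+≤+ (begin
    + (p + b * n)
      ≡⟨ cong (λ x → (+ p) ℤ.+ x) (ℤP.pos-* b n) ⟩
    + p ℤ.+ + b ℤ.* + n
      ≤⟨ ℤP.+-monoˡ-≤ (+ b ℤ.* + n) hyp ⟩
    + a ℤ.* + b ℤ.- (+ n ℤ.- + c) ℤ.* (+ a ℤ.+ + b ℤ.- + n) ℤ.+ + b ℤ.* + n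
      ≡⟨ identity (+ a) (+ b) (+ c) (+ n) ⟩
    (+ n ℤ.- + c) ℤ.* (+ n ℤ.- + a) ℤ.+ + b ℤ.* (+ a ℤ.+ + c)
      ≡⟨ cong₂ (λ x y → x ℤ.* y ℤ.+ + b ℤ.* (+ a ℤ.+ + c)) n-c n-a ⟩
    + c' ℤ.* + a' ℤ.+ + b ℤ.* + (a + c)
      ≡⟨ cong₂ ℤ._+_ (ℤP.pos-* c' a') (ℤP.pos-* b (a + c)) ⟨
    + (c' * a' + b * (a + c)) ∎)
    where
    open ℤP.≤-Reasoning
    identity : ∀ (A B C N : ℤ) →
      A ℤ.* B ℤ.- (N ℤ.- C) ℤ.* (A ℤ.+ B ℤ.- N) ℤ.+ B ℤ.* N ≡ (N ℤ.- C) ℤ.* (N ℤ.- A) ℤ.+ B ℤ.* (A ℤ.+ C)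
    identity = ℤ-Solver.solve-∀
    n-c : + n ℤ.- + c ≡ + c'
    n-c = trans (cong (λ m → + m ℤ.- + c) (sym c'+c≡n)) (+[m+n]-+n≡+m c' c)
    n-a : + n ℤ.- + a ≡ + a'
    n-a = +[m+n]-+n≡+m a' a

  module _ {n : ℕ} (T : MarkedBrick n) where
    open MarkedBrick T

    XY XZ YZ : Fin n → Fin n → Bool
    XY i j = mem I i ∧ (mem J j ∧ anyF (λ σ → mem K σ ∧ mk T i j σ))
    XZ i σ = mem I i ∧ (mem K σ ∧ anyF (λ j → mem J j ∧ mk T i j σ))
    YZ j σ = mem J j ∧ (mem K σ ∧ anyF (λ i → mem I i ∧ mk T i j σ))

    XY-count-row : ∀ i → mem I i ≡ true → count (XY i) ≡ xLayerY T i
    XY-count-row i i∈I = count-cong {f = XY i} (λ j → ∧-trueˡ i∈I)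

    XZ-count-row : ∀ i → mem I i ≡ true → count (XZ i) ≡ xLayerZ T i
    XZ-count-row i i∈I = count-cong {f = XZ i} (λ σ → ∧-trueˡ i∈I)

    XY-count-column : ∀ j → mem J j ≡ true → count (λ i → XY i j) ≡ yLayerX T j
    XY-count-column j j∈J = count-cong {f = λ i → XY i j} (λ i → cong (mem I i ∧_) (∧-trueˡ j∈J))

    YZ-count-row : ∀ j → mem J j ≡ true → count (YZ j) ≡ yLayerZ T j
    YZ-count-row j j∈J = count-cong {f = YZ j} (λ σ → ∧-trueˡ j∈J)

    XZ-count-column : ∀ σ → mem K σ ≡ true → count (λ i → XZ i σ) ≡ zLayerX T σ
    XZ-count-column σ σ∈K = count-cong {f = λ i → XZ i σ} (λ i → cong (mem I i ∧_) (∧-trueˡ σ∈K))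

    YZ-count-column : ∀ σ → mem K σ ≡ true → count (λ j → YZ j σ) ≡ zLayerY T σ
    YZ-count-column σ σ∈K = count-cong {f = λ j → YZ j σ} (λ j → cong (mem J j ∧_) (∧-trueˡ σ∈K))

    XY-count : ∀ i → (∀ i → mem I i ≡ true → xLayerZ T i ≡ xLayerY T i) →
      count (XY i) ≡ (if mem I i then Nx T i else 0)
    XY-count i possible with bool-cases (mem I i)
    ... | inj₁ i∈I = trans (XY-count-row i i∈I) (trans (sym (possible i i∈I)) (sym (if-cong i∈I)))
    ... | inj₂ i∉I = trans (count-none {f = XY i} (λ j → ∧-falseˡ i∉I)) (sym (if-cong i∉I))

    YZ-count : ∀ j → count (YZ j) ≡ (if mem J j then Ny T j else 0)
    YZ-count j with bool-cases (mem J j)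
    ... | inj₁ j∈J = trans (YZ-count-row j j∈J) (sym (if-cong j∈J))
    ... | inj₂ j∉J = trans (count-none {f = YZ j} (λ σ → ∧-falseˡ j∉J)) (sym (if-cong j∉J))

    marked⇒XY : ∀ {i j σ} → mark (i , j , σ) ≢ blank → inBrick I J K (i , j , σ) → XY i j ≡ true
    marked⇒XY {i} {j} {σ} marked (i∈I , j∈J , σ∈K) rewrite i∈I | j∈J =
      anyF-intro _ σ (trans (∧-trueˡ σ∈K) (isMarked-≢blank _ marked))

    marked⇒XZ : ∀ {i j σ} → mark (i , j , σ) ≢ blank → inBrick I J K (i , j , σ) → XZ i σ ≡ true
    marked⇒XZ {i} {j} {σ} marked (i∈I , j∈J , σ∈K) rewrite i∈I | σ∈K =
      anyF-intro _ j (trans (∧-trueˡ j∈J) (isMarked-≢blank _ marked))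

    marked⇒YZ : ∀ {i j σ} → mark (i , j , σ) ≢ blank → inBrick I J K (i , j , σ) → YZ j σ ≡ true
    marked⇒YZ {i} {j} {σ} marked (i∈I , j∈J , σ∈K) rewrite j∈J | σ∈K =
      anyF-intro _ i (trans (∧-trueˡ i∈I) (isMarked-≢blank _ marked))

    module Embed (compact : Compact T)
      (boundˣ : ∀ i → mem I i ≡ true → (+ Nx T i) ℤ.≥ (+ ∣ J ∣) ℤ.+ (+ ∣ K ∣) ℤ.- (+ n))
      (boundʸ : ∀ j → mem J j ≡ true → (+ Ny T j) ℤ.≥ (+ ∣ I ∣) ℤ.+ (+ ∣ K ∣) ℤ.- (+ n))
      (boundᶻ : ∀ σ → mem K σ ≡ true → (+ Nz T σ) ℤ.≥ (+ ∣ I ∣) ℤ.+ (+ ∣ J ∣) ℤ.- (+ n))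
      (capacity : (+ potential T) ℤ.≤ (+ ∣ I ∣) ℤ.* (+ ∣ J ∣) ℤ.- ((+ n) ℤ.- (+ ∣ K ∣)) ℤ.*
          ((+ ∣ I ∣) ℤ.+ (+ ∣ J ∣) ℤ.- (+ n)))
      where

      valid : ValidMarking T
      valid = proj₁ compact

      marked-inside : ∀ {t} → mark t ≢ blank → inBrick I J K t
      marked-inside {t} = proj₁ valid t

      possibleˣ : ∀ i → mem I i ≡ true → xLayerZ T i ≡ xLayerY T i
      possibleˣ = proj₁ (proj₂ compact)

      possibleʸ : ∀ j → mem J j ≡ true → yLayerZ T j ≡ yLayerX T j
      possibleʸ = proj₁ (proj₂ (proj₂ compact))

      possibleᶻ : ∀ σ → mem K σ ≡ true → zLayerY T σ ≡ zLayerX T σ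
      possibleᶻ = proj₁ (proj₂ (proj₂ (proj₂ compact)))

      Σx≡Σy : sumNx T ≡ sumNy T
      Σx≡Σy = proj₁ (proj₂ (proj₂ (proj₂ (proj₂ compact))))

      bound-counts : ∀ {p q p' q' N N'} → p ≡ p' → q ≡ q' → N' ≡ N →
        + N ℤ.≥ (+ p) ℤ.+ (+ q) ℤ.- (+ n) → p' + q' ≤ N' + n
      bound-counts refl refl refl hyp = bound-in-ℕ hyp

      capacity-counts : (+ potential T) ℤ.≤ (+ count (mem I)) ℤ.* (+ count (mem J))
        ℤ.- ((+ n) ℤ.- (+ count (mem K))) ℤ.* ((+ count (mem I)) ℤ.+ (+ count (mem J)) ℤ.- (+ n))
      capacity-counts rewrite sym (∣∣≡count I) | sym (∣∣≡count J) | sym (∣∣≡count K) = capacity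

      YZ-total : sumF (count ∘ YZ) ≡ potential T
      YZ-total = trans (sumF-cong YZ-count) (sym Σx≡Σy)

      capacity-shadow : sumF (count ∘ YZ) + count (mem J) * n ≤
        count (not ∘ mem K) * count (not ∘ mem I) + count (mem J) * (count (mem I) + count (mem K))
      capacity-shadow rewrite YZ-total =
        capacity-in-ℕ {a = count (mem I)} {count (mem J)} {count (mem K)} {count (not ∘ mem I)} {count
            (not ∘ mem K)}
          (count-not (mem I)) (count-not (mem K)) capacity-counts

      shadow : BrickShadow
      shadow = record
        { n = n ; inI = mem I ; inJ = mem J ; inK = mem K ; XY = XY ; XZ = XZ ; YZ = YZ
        ; XY⇒I = ∧-conicalˡ _ _
        ; XY⇒J = λ {i} h → ∧-conicalˡ _ _ (∧-conicalʳ (mem I i) _ h)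
        ; XZ⇒I = ∧-conicalˡ _ _
        ; XZ⇒K = λ {i} h → ∧-conicalˡ _ _ (∧-conicalʳ (mem I i) _ h)
        ; YZ⇒J = ∧-conicalˡ _ _
        ; YZ⇒K = λ {j} h → ∧-conicalˡ _ _ (∧-conicalʳ (mem J j) _ h)
        ; possibleˣ = λ i i∈I → trans (XY-count-row i i∈I)
            (trans (sym (possibleˣ i i∈I)) (sym (XZ-count-row i i∈I)))
        ; possibleʸ = λ j j∈J → trans (XY-count-column j j∈J)
            (trans (sym (possibleʸ j j∈J)) (sym (YZ-count-row j j∈J)))
        ; possibleᶻ = λ σ σ∈K → trans (XZ-count-column σ σ∈K)
            (trans (sym (possibleᶻ σ σ∈K)) (sym (YZ-count-column σ σ∈K)))
        ; boundˣ = λ i i∈I → bound-counts (∣∣≡count J) (∣∣≡count K) (XZ-count-row i i∈I) (boundˣ i i∈I)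
        ; boundʸ = λ j j∈J → bound-counts (∣∣≡count I) (∣∣≡count K) (YZ-count-row j j∈J) (boundʸ j j∈J)
        ; boundᶻ = λ σ σ∈K → bound-counts (∣∣≡count I) (∣∣≡count J) (YZ-count-column σ σ∈K) (boundᶻ σ σ∈K)
        ; capacity = capacity-shadow
        }

      open Filling shadow

      free : Fin n → Fin n → Bool
      free x y = not (XY x y)

      module Free = RelationEdges free

      newRook : Fin Free.size → Cell n
      newRook i = proj₁ (Free.edge i) , proj₂ (Free.edge i) , L (proj₁ (Free.edge i)) (proj₂ (Free.edge i))

      newRook-free : ∀ i → XY (proj₁ (Free.edge i)) (proj₂ (Free.edge i)) ≡ false
      newRook-free i = not≡true⇒≡false (Free.edge-related i)

      rooks : List (Cell n)
      rooks = tabulate newRook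

      rooks-count : length rooks + potential T ≡ n ^ 2
      rooks-count = begin
        length rooks + potential T
          ≡⟨ cong₂ _+_ (trans (length-tabulate newRook) Free.size-sumF)
              (sym (sumF-cong (λ i → XY-count i possibleˣ))) ⟩
        sumF (count ∘ free) + sumF (count ∘ XY)
          ≡⟨ sumF-+ (count ∘ free) (count ∘ XY) ⟨
        sumF (λ x → count (free x) + count (XY x))
          ≡⟨ sumF-cong (λ x → count-not (XY x)) ⟩
        sumF {n} (λ _ → n)
          ≡⟨ sumF-const {n} n ⟩
        n * n
          ≡⟨ cong (n *_) (*-identityʳ n) ⟨
        n ^ 2 ∎
        where open ≡-Reasoning

      rooks-outside : ∀ r → r ∈ rooks → ¬ inBrick I J K r
      rooks-outside r r∈rooks (x∈I , y∈J , z∈K) with ∈-tabulate⁻ r∈rooks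
      ... | i , refl = bool-absurd z∈K (L-∉K (newRook-free i) x∈I y∈J)

      rooks-non-attacking : AllPairs (λ r s → ¬ onCommonLine r s) rooks
      rooks-non-attacking = tabulate⁺ distinct-lines
        where
        distinct-lines : ∀ {i j} → i ≢ j → ¬ onCommonLine (newRook i) (newRook j)
        distinct-lines {i} {j} i≢j (inj₁ (x≡x' , y≡y')) = i≢j (Free.edge-injective (cong₂ _,_ x≡x' y≡y'))
        distinct-lines {i} {j} i≢j (inj₂ (inj₁ (x≡x' , z≡z'))) = i≢j (Free.edge-injective (cong₂ _,_ x≡x'
          (L-row-injective (newRook-free i) (subst (λ x → XY x _ ≡ false) (sym x≡x') (newRook-free j))
            (trans z≡z' (cong (λ x → L x _) (sym x≡x'))))))
        distinct-lines {i} {j} i≢j (inj₂ (inj₂ (y≡y' , z≡z'))) = i≢j (Free.edge-injective (cong₂ _,_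
          (L-column-injective (newRook-free i) (subst (λ y → XY _ y ≡ false) (sym y≡y') (newRook-free j))
            (trans z≡z' (cong (L _) (sym y≡y'))))
          y≡y'))

      rooks-avoid-marks : ∀ r t → r ∈ rooks → mark t ≢ blank → ¬ onCommonLine r t
      rooks-avoid-marks r t r∈rooks marked line with ∈-tabulate⁻ r∈rooks
      ... | i , refl with line
      ... | inj₁ (x≡ , y≡) =
            bool-absurd (marked⇒XY marked (marked-inside marked))
                (subst₂ (λ x y → XY x y ≡ false) x≡ y≡ (newRook-free i))
      ... | inj₂ (inj₁ (x≡ , z≡)) =
            bool-absurd (marked⇒XZ marked (marked-inside marked))
                (subst₂ (λ x z → XZ x z ≡ false) x≡ z≡ (L-∉XZ (newRook-free i)))
      ... | inj₂ (inj₂ (y≡ , z≡)) =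
            bool-absurd (marked⇒YZ marked (marked-inside marked))
                (subst₂ (λ y z → YZ y z ≡ false) y≡ z≡ (L-∉YZ (newRook-free i)))

open import Defs
open import Data.Nat using (ℕ; _≥_; _^_; _+_)
open import Data.Integer using (ℤ; +_; _-_; _*_; _≤_)
import Data.Integer as Z
open import Data.Fin.Subset using (∣_∣)
open import Data.Bool using (true)
open import Data.List using (List; length)
open import Data.List.Membership.Propositional using (_∈_)
open import Data.List.Relation.Unary.AllPairs using (AllPairs)
open import Data.Product using (Σ; _×_; _,_)
open import Relation.Nullary using (¬_)
open import Relation.Binary.PropositionalEquality using (_≡_; _≢_)

mainTheorem3 : (n : ℕ) → n ≥ 1 → (T : MarkedBrick n) →
  let open MarkedBrick T
      a = ∣ I ∣
      b = ∣ J ∣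
      c = ∣ K ∣
      p0 = potential T
  in Compact T →
     (∀ i → mem I i ≡ true → (+ Nx T i) Z.≥ (+ b) Z.+ (+ c) - (+ n)) →
     (∀ j → mem J j ≡ true → (+ Ny T j) Z.≥ (+ a) Z.+ (+ c) - (+ n)) →
     (∀ σ → mem K σ ≡ true → (+ Nz T σ) Z.≥ (+ a) Z.+ (+ b) - (+ n)) →
     (+ p0) ≤ (+ a) * (+ b) - ((+ n) - (+ c)) * ((+ a) Z.+ (+ b) - (+ n)) →
     Σ (List (Cell n)) λ R →
         (length R + p0 ≡ n ^ 2)
       × (∀ r → r ∈ R → ¬ inBrick I J K r)
       × AllPairs (λ r s → ¬ onCommonLine r s) R
       × (∀ r t → r ∈ R → mark t ≢ blank → ¬ onCommonLine r t)
mainTheorem3 n _ T compact boundˣ boundʸ boundᶻ capacity =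
  rooks , rooks-count , rooks-outside , rooks-non-attacking , rooks-avoid-marks
  where open Embed T compact boundˣ boundʸ boundᶻ capacity
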